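{- Let $F$ be a 4-regular graph with $c(F)$ connected components and $n$ vertices. Then there is a matroid $M_{\tau}(F)$ of rank $n$ defined on the set $\mathfrak{T}(F)$ of transitions of $F$ such that for every circuit partition $P$ of $F$, the rank of $\tau(P)$ in $M_{\tau}(F)$ is \[ r(\tau(P)) = n + c(F) - |P|, \] where $|P|$ is the number of circuits in $P$.
   Context: Graphs are finite and may have loops and multiple edges. Each edge consists of two distinct half-edges, each incident on exactly one vertex (both half-edges of a loop are incident on the same vertex). A graph is 4-regular if every vertex has exactly four incident half-edges. A circuit in a graph is a sequence $v_1,h_1,h_1',v_2,h_2,h_2',\dots,v_k,h_k,h_k'=h_0',v_{k+1}=v_1$ such that for each $i\in\{1,\dots,k\}$, $h_i$ and $h_i'$ are the two half-edges of a single edge and $h_{i-1}'$ and $h_i$ are both incident on $v_i$; the half-edges appearing must be pairwise distinct (vertices may repeat). Two circuits are the same if they differ by cyclic permutations and reversals. A circuit partition of $F$ is a partition of $E(F)$ into the edge sets of edge-disjoint circuits. A transition at a vertex $v$ is a partition of the four half-edges incident on $v$ into two pairs; there are three transitions at each vertex, and $\mathfrak{T}(F)$ denotes the set of all transitions of $F$. Each passage $h_{i-1}',v_i,h_i$ of a circuit through a vertex pairs two half-edges at $v_i$; the two passages through $v$ made by the circuits of a circuit partition $P$ form a transition at $v$. $\tau(P)\subseteq\mathfrak{T}(F)$ denotes the set of transitions used by $P$, one at each vertex; $\tau$ is a bijection from circuit partitions of $F$ onto the sets containing exactly one transition at each vertex. -}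

module Defs where

open import Data.Nat using (ℕ; zero; suc; _+_; _*_; _≤_)
open import Data.Fin using (Fin; zero; suc; fromℕ; inject₁; combine)
open import Data.Fin.Subset using (Subset; ∣_∣; _⊆_; _∪_; _∩_; ⊤; _∈_)
open import Data.Product using (Σ; ∃; _×_; _,_; proj₁; proj₂)
open import Data.Sum using (_⊎_; inj₁; inj₂)
open import Relation.Binary.PropositionalEquality using (_≡_; _≢_)
open import Relation.Binary.Construct.Closure.ReflexiveTransitive using (Star)
open import Function.Bundles using (_⇔_)

record Matroid (m : ℕ) : Set where
  field
    rank      : Subset m → ℕ
    rank-card : ∀ X → rank X ≤ ∣ X ∣
    rank-mono : ∀ {X Y} → X ⊆ Y → rank X ≤ rank Y
    rank-sub  : ∀ X Y → rank (X ∪ Y) + rank (X ∩ Y) ≤ rank X + rank Y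

-- 4-regular graphs on n vertices (loops and multi-edges allowed).
-- Half-edges incident on vertex v are (v , 0..3); the edges are given by a
-- fixed-point-free involution σ pairing the two half-edges of each edge.

HalfEdge : ℕ → Set
HalfEdge n = Fin n × Fin 4

vertex : ∀ {n} → HalfEdge n → Fin n
vertex = proj₁

slot : ∀ {n} → HalfEdge n → Fin 4
slot = proj₂

record FourRegular (n : ℕ) : Set where
  field
    σ      : HalfEdge n → HalfEdge n
    σ-invol : ∀ h → σ (σ h) ≡ h
    σ-fpf   : ∀ h → σ h ≢ h

open FourRegular public

Adj : ∀ {n} → FourRegular n → Fin n → Fin n → Set
Adj F u v = ∃ λ a → ∃ λ b → σ F (u , a) ≡ (v , b)

Connected : ∀ {n} → FourRegular n → Fin n → Fin n → Set
Connected F = Star (Adj F)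

HasComponents : ∀ {n} → FourRegular n → ℕ → Set
HasComponents {n} F c =
  Σ (Fin n → Fin c) λ f →
    (∀ y → ∃ λ x → f x ≡ y) ×
    (∀ u v → (f u ≡ f v) ⇔ Connected F u v)

-- Circuits.  A circuit v_1,h_1,h_1',...,v_k,h_k,h_k' with k = suc len is
-- given by h_i (i : Fin k); h_i' = σ h_i and v_i = vertex h_i.

prev : ∀ {k} → Fin (suc k) → Fin (suc k)
prev {k} zero = fromℕ k
prev (suc i) = inject₁ i

halves : ∀ {n k} → FourRegular n → (Fin k → HalfEdge n) → Fin k ⊎ Fin k → HalfEdge n
halves F he (inj₁ i) = he i
halves F he (inj₂ i) = σ F (he i)

record Circuit {n : ℕ} (F : FourRegular n) : Set where
  field
    len      : ℕ
    he       : Fin (suc len) → HalfEdge n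
    -- h'_{i-1} and h_i are both incident on v_i (indices cyclic, h'_0 = h'_k)
    passage  : ∀ i → vertex (σ F (he (prev i))) ≡ vertex (he i)
    distinct : ∀ (x y : Fin (suc len) ⊎ Fin (suc len)) →
               halves F he x ≡ halves F he y → x ≡ y

open Circuit public

-- Circuit partitions: a family of `size` edge-disjoint circuits whose edge
-- sets cover E(F); |P| = size.  Edge sets are unions of whole edges, so this
-- is: every half-edge occurs in some circuit, and in at most one circuit.

record CircuitPartition {n : ℕ} (F : FourRegular n) : Set where
  field
    size     : ℕ
    circ     : Fin size → Circuit F
    cover    : ∀ x → ∃ λ j → ∃ λ s → halves F (he (circ j)) s ≡ x
    disjoint : ∀ j j' s s' →
               halves F (he (circ j)) s ≡ halves F (he (circ j')) s' → j ≡ j'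

open CircuitPartition public

-- Transitions.  The three transitions at v are indexed by Fin 3:
--   0 : {0,1}{2,3}    1 : {0,2}{1,3}    2 : {0,3}{1,2}
-- mate t a is the slot paired with slot a by transition t.

mate : Fin 3 → Fin 4 → Fin 4
mate zero zero = suc zero
mate zero (suc zero) = zero
mate zero (suc (suc zero)) = suc (suc (suc zero))
mate zero (suc (suc (suc zero))) = suc (suc zero)
mate (suc zero) zero = suc (suc zero)
mate (suc zero) (suc zero) = suc (suc (suc zero))
mate (suc zero) (suc (suc zero)) = zero
mate (suc zero) (suc (suc (suc zero))) = suc zero
mate (suc (suc zero)) zero = suc (suc (suc zero))
mate (suc (suc zero)) (suc zero) = suc (suc zero)
mate (suc (suc zero)) (suc (suc zero)) = suc zero
mate (suc (suc zero)) (suc (suc (suc zero))) = zero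

-- The transition set 𝔗(F) is encoded as Fin (n * 3): (v , t) ↦ combine v t.
transition : ∀ {n} → Fin n → Fin 3 → Fin (n * 3)
transition = combine

-- Transition t at v belongs to τ(P): some passage h'_{i-1}, v, h_i of a circuit
-- of P through v pairs two half-edges at v according to t.
Uses : ∀ {n} {F : FourRegular n} → CircuitPartition F → Fin n → Fin 3 → Set
Uses {F = F} P v t =
  ∃ λ j → ∃ λ i →
    vertex (he (circ P j) i) ≡ v ×
    mate t (slot (σ F (he (circ P j) (prev i)))) ≡ slot (he (circ P j) i)

IsTau : ∀ {n} {F : FourRegular n} → CircuitPartition F → Subset (n * 3) → Set
IsTau {n} P S = ∀ (v : Fin n) (t : Fin 3) → (transition v t ∈ S) ⇔ Uses P v t

-- Work in GF(2)^H, where H is the set of 4n half-edges.  Transition t at v is represented by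
-- e_h + e_h' for the pair {h , h'} of t through slot 0 of v, and M_τ(F) is the linear matroid
-- of these vectors contracted by the span K of the edge vectors e_h + e_σh and the vertex
-- vectors (the sum of the four half-edges at a vertex).  For a circuit partition P, the
-- vectors of τ(P) together with K span exactly the vectors whose coordinates sum to zero
-- along every circuit of P: each passage of a circuit contributes e_h'+e_h, each edge
-- e_h+e_σh, and these link all half-edges of a circuit.  So the rank is 4n - |P|, and
-- likewise 4n - c(F) for all transitions, the classes then being the components of F.
-- Finally dim K = 3n - c(F): K is the preimage under w ↦ w + σw of the coboundaries of the
-- vertex functions, whose space has dimension n - c(F).
module Submission where

open import Algebra.Properties.CommutativeSemigroup using (interchange)
open import Data.Bool using (Bool; true; false; _xor_; _∧_; _∨_; not)
open import Data.Bool.Properties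
  using (∧-distribˡ-xor; ∧-zeroʳ; ∧-identityʳ; xor-assoc; xor-comm; xor-same; xor-identityˡ; xor-identityʳ)
  renaming (_≟_ to _≟ᵇ_)
open import Data.Empty using (⊥; ⊥-elim)
open import Data.Fin using (Fin; zero; suc; punchIn; punchOut; combine; remQuot; toℕ; inject₁; lower₁)
open import Data.Fin.Induction using (<-weakInduction)
open import Data.Fin.Properties
  using (punchOut-cong; punchOut-injective; punchOut-punchIn; punchInᵢ≢i; toℕ-injective; toℕ-fromℕ;
         fromℕ≢inject₁; inject₁-injective; inject₁-lower₁; all?; any?; remQuot-combine; combine-remQuot)
  renaming (_≟_ to _≟ᶠ_; _<?_ to _<?ᶠ_; <-cmp to <-cmpᶠ)
open import Data.Fin.Subset using (⊤; Subset; ∣_∣; _⊆_; _∪_; _∩_) renaming (_∈_ to _∈ˢ_)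
open import Data.Fin.Subset.Properties using (∈⊤; x∈p∪q⁻; x∈p∪q⁺; x∈p∩q⁻)
open import Data.List using (List; []; _∷_; _++_; length)
import Data.List as List
open import Data.List.Membership.Propositional using (_∈_)
open import Data.List.Membership.Propositional.Properties using (∈-++⁺ˡ; ∈-++⁺ʳ; ∈-++⁻; ∈-tabulate⁺; ∈-tabulate⁻)
open import Data.List.Relation.Unary.Any using (Any; here; there)
import Data.List.Relation.Unary.Any.Properties as Any
open import Data.Nat using (ℕ; zero; suc; _+_; _*_; _∸_; _^_; _≤_; z≤n; s≤s)
open import Data.Nat.Properties renaming (_≟_ to _≟ⁿ_)
open import Data.Nat.Tactic.RingSolver using (solve-∀)
open import Data.Product using (Σ; ∃; _×_; _,_; proj₁; proj₂)
open import Data.Product.Properties using (×-≡,≡→≡)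
open import Data.Sum using (_⊎_; inj₁; inj₂; [_,_]′)
open import Data.Sum.Properties using (inj₂-injective)
open import Data.Unit using (tt) renaming (⊤ to Unit)
open import Data.Vec using (Vec; []; _∷_; lookup; zipWith; replicate; tabulate)
  renaming (here to hereˢ; there to thereˢ)
open import Data.Vec.Properties
  using (lookup∘tabulate; ∷-injectiveʳ; zipWith-assoc; zipWith-comm; zipWith-identityˡ; zipWith-identityʳ;
         lookup-zipWith; lookup-replicate; tabulate∘lookup; tabulate-cong)
  renaming (≡-dec to ≡-decᵛ)
open import Function using (_∘_; flip; id)
open import Function.Bundles using (_⇔_; mk⇔; Equivalence)
open import Relation.Binary.Construct.Closure.ReflexiveTransitive using (Star; ε; _◅_; _◅◅_)
  renaming (map to star-map)
open import Relation.Binary.Definitions using (tri<; tri≈; tri>)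
open import Relation.Binary.PropositionalEquality
  using (_≡_; _≢_; refl; sym; trans; cong; cong₂; subst; subst₂; module ≡-Reasoning)
open import Relation.Nullary using (Dec; yes; no; ¬_; does)
open import Relation.Nullary.Decidable
  using (dec-true; dec-false; does-⇔; _×-dec_; _⊎-dec_; _→-dec_; ¬?; toWitness)

open import Defs

-- Vectors over GF(2)

Bits : ℕ → Set
Bits = Vec Bool

infixl 6 _⊕_

_⊕_ : ∀ {m} → Bits m → Bits m → Bits m
_⊕_ = zipWith _xor_

𝟘 : ∀ {m} → Bits m
𝟘 = replicate _ false

_≟ᵛ_ : ∀ {m} (x y : Bits m) → Dec (x ≡ y)
_≟ᵛ_ = ≡-decᵛ _≟ᵇ_

module _ {m : ℕ} where

  ⊕-assoc : ∀ (x y z : Bits m) → (x ⊕ y) ⊕ z ≡ x ⊕ (y ⊕ z)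
  ⊕-assoc = zipWith-assoc xor-assoc

  ⊕-comm : ∀ (x y : Bits m) → x ⊕ y ≡ y ⊕ x
  ⊕-comm = zipWith-comm xor-comm

  ⊕-identityˡ : ∀ (x : Bits m) → 𝟘 ⊕ x ≡ x
  ⊕-identityˡ = zipWith-identityˡ xor-identityˡ

  ⊕-identityʳ : ∀ (x : Bits m) → x ⊕ 𝟘 ≡ x
  ⊕-identityʳ = zipWith-identityʳ xor-identityʳ

  lookup-⊕ : ∀ (x y : Bits m) i → lookup (x ⊕ y) i ≡ lookup x i xor lookup y i
  lookup-⊕ x y i = lookup-zipWith _xor_ i x y

  lookup-𝟘 : ∀ (i : Fin m) → lookup (𝟘 {m}) i ≡ false
  lookup-𝟘 i = lookup-replicate i false

  ≗⇒≡ : ∀ {x y : Bits m} → (∀ i → lookup x i ≡ lookup y i) → x ≡ y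
  ≗⇒≡ {x} {y} p = trans (sym (tabulate∘lookup x)) (trans (tabulate-cong p) (tabulate∘lookup y))

  ⊕-self : ∀ (x : Bits m) → x ⊕ x ≡ 𝟘
  ⊕-self x = ≗⇒≡ λ i → trans (lookup-⊕ x x i) (trans (xor-same (lookup x i)) (sym (lookup-𝟘 i)))

  ⊕-cancelʳ : ∀ (x y : Bits m) → (x ⊕ y) ⊕ y ≡ x
  ⊕-cancelʳ x y = begin
    (x ⊕ y) ⊕ y  ≡⟨ ⊕-assoc x y y ⟩
    x ⊕ (y ⊕ y)  ≡⟨ cong (x ⊕_) (⊕-self y) ⟩
    x ⊕ 𝟘        ≡⟨ ⊕-identityʳ x ⟩
    x            ∎
    where open ≡-Reasoning

  ⊕-cancelˡ : ∀ (x y : Bits m) → x ⊕ (x ⊕ y) ≡ y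
  ⊕-cancelˡ x y = begin
    x ⊕ (x ⊕ y)  ≡⟨ sym (⊕-assoc x x y) ⟩
    (x ⊕ x) ⊕ y  ≡⟨ cong (_⊕ y) (⊕-self x) ⟩
    𝟘 ⊕ y        ≡⟨ ⊕-identityˡ y ⟩
    y            ∎
    where open ≡-Reasoning

  ⊕≡𝟘⇒≡ : ∀ {x y : Bits m} → x ⊕ y ≡ 𝟘 → x ≡ y
  ⊕≡𝟘⇒≡ {x} {y} eq = trans (sym (⊕-cancelʳ x y)) (trans (cong (_⊕ y) eq) (⊕-identityˡ y))

  ⊕-interchange : ∀ (a b c d : Bits m) → (a ⊕ b) ⊕ (c ⊕ d) ≡ (a ⊕ c) ⊕ (b ⊕ d)
  ⊕-interchange a b c d = begin
    (a ⊕ b) ⊕ (c ⊕ d)  ≡⟨ ⊕-assoc a b (c ⊕ d) ⟩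
    a ⊕ (b ⊕ (c ⊕ d))  ≡⟨ cong (a ⊕_) (sym (⊕-assoc b c d)) ⟩
    a ⊕ ((b ⊕ c) ⊕ d)  ≡⟨ cong (λ z → a ⊕ (z ⊕ d)) (⊕-comm b c) ⟩
    a ⊕ ((c ⊕ b) ⊕ d)  ≡⟨ cong (a ⊕_) (⊕-assoc c b d) ⟩
    a ⊕ (c ⊕ (b ⊕ d))  ≡⟨ sym (⊕-assoc a c (b ⊕ d)) ⟩
    (a ⊕ c) ⊕ (b ⊕ d)  ∎
    where open ≡-Reasoning

xor≡false⇒≡ : ∀ {a b} → a xor b ≡ false → a ≡ b
xor≡false⇒≡ {false} {false} _ = refl
xor≡false⇒≡ {true} {true} _ = refl

e : ∀ {m} → Fin m → Bits m
e zero = true ∷ 𝟘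
e (suc i) = false ∷ e i

lookup-e : ∀ {m} (i j : Fin m) → lookup (e i) j ≡ does (i ≟ᶠ j)
lookup-e zero zero = refl
lookup-e zero (suc j) = lookup-𝟘 j
lookup-e (suc i) zero = refl
lookup-e (suc i) (suc j) = lookup-e i j

scale : ∀ {m} → Bool → Bits m → Bits m
scale true v = v
scale false _ = 𝟘

⨁ : ∀ {N m} → (Fin N → Bits m) → Bits m
⨁ {zero} g = 𝟘
⨁ {suc N} g = g zero ⊕ ⨁ (g ∘ suc)

module _ {m : ℕ} where

  lookup-scale : ∀ c (x : Bits m) i → lookup (scale c x) i ≡ c ∧ lookup x i
  lookup-scale true x i = refl
  lookup-scale false x i = lookup-𝟘 i

  scale-⊕ : ∀ c (u v : Bits m) → scale c (u ⊕ v) ≡ scale c u ⊕ scale c v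
  scale-⊕ true u v = refl
  scale-⊕ false u v = sym (⊕-self 𝟘)

  scale-xor : ∀ a b (v : Bits m) → scale (a xor b) v ≡ scale a v ⊕ scale b v
  scale-xor false b v = sym (⊕-identityˡ _)
  scale-xor true false v = sym (⊕-identityʳ v)
  scale-xor true true v = sym (⊕-self v)

⨁-cong : ∀ {N m} {g h : Fin N → Bits m} → (∀ i → g i ≡ h i) → ⨁ g ≡ ⨁ h
⨁-cong {zero} p = refl
⨁-cong {suc N} p = cong₂ _⊕_ (p zero) (⨁-cong (p ∘ suc))

⨁-⊕ : ∀ {N m} (g h : Fin N → Bits m) → ⨁ (λ i → g i ⊕ h i) ≡ ⨁ g ⊕ ⨁ h
⨁-⊕ {zero} g h = sym (⊕-self 𝟘)
⨁-⊕ {suc N} g h = trans (cong (g zero ⊕ h zero ⊕_) (⨁-⊕ (g ∘ suc) (h ∘ suc)))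
                        (⊕-interchange (g zero) (h zero) (⨁ (g ∘ suc)) (⨁ (h ∘ suc)))

⨁-𝟘 : ∀ {N m} (g : Fin N → Bits m) → (∀ i → g i ≡ 𝟘) → ⨁ g ≡ 𝟘
⨁-𝟘 {zero} g p = refl
⨁-𝟘 {suc N} g p = trans (cong₂ _⊕_ (p zero) (⨁-𝟘 (g ∘ suc) (p ∘ suc))) (⊕-self 𝟘)

⨁-select : ∀ {N m} (i : Fin N) (g : Fin N → Bits m) → ⨁ (λ x → scale (lookup (e i) x) (g x)) ≡ g i
⨁-select {suc N} zero g =
  trans (cong (g zero ⊕_) (⨁-𝟘 _ (λ x → cong (λ b → scale b (g (suc x))) (lookup-𝟘 x)))) (⊕-identityʳ (g zero))
⨁-select {suc N} (suc i) g = trans (⊕-identityˡ _) (⨁-select i (g ∘ suc))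

⨁-basis : ∀ {N} (w : Bits N) → ⨁ (λ x → scale (lookup w x) (e x)) ≡ w
⨁-basis [] = refl
⨁-basis (b ∷ w) = begin
  scale b (e zero) ⊕ ⨁ (λ x → scale (lookup w x) (false ∷ e x))
    ≡⟨ cong (scale b (e zero) ⊕_) (trans (⨁-cong (λ x → scale-∷ (lookup w x) (e x))) (⨁-∷ (λ x → scale (lookup w x) (e x)))) ⟩
  scale b (e zero) ⊕ (false ∷ ⨁ (λ x → scale (lookup w x) (e x)))
    ≡⟨ cong (λ z → scale b (e zero) ⊕ (false ∷ z)) (⨁-basis w) ⟩
  scale b (e zero) ⊕ (false ∷ w)
    ≡⟨ head-tail b ⟩
  b ∷ w ∎
  where
  open ≡-Reasoning
  scale-∷ : ∀ {m} c (v : Bits m) → scale c (false ∷ v) ≡ false ∷ scale c v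
  scale-∷ true v = refl
  scale-∷ false v = refl
  ⨁-∷ : ∀ {N m} (h : Fin N → Bits m) → ⨁ (λ x → false ∷ h x) ≡ false ∷ ⨁ h
  ⨁-∷ {zero} h = refl
  ⨁-∷ {suc N} h = cong ((false ∷ h zero) ⊕_) (⨁-∷ (h ∘ suc))
  head-tail : ∀ b → scale b (e zero) ⊕ (false ∷ w) ≡ b ∷ w
  head-tail true = cong (true ∷_) (⊕-identityˡ w)
  head-tail false = cong (false ∷_) (⊕-identityˡ w)

record IsLinear {a b} (φ : Bits a → Bits b) : Set where
  field
    additive : ∀ x y → φ (x ⊕ y) ≡ φ x ⊕ φ y

  φ-𝟘 : φ 𝟘 ≡ 𝟘
  φ-𝟘 = begin
    φ 𝟘                  ≡⟨ sym (⊕-cancelʳ (φ 𝟘) (φ 𝟘)) ⟩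
    (φ 𝟘 ⊕ φ 𝟘) ⊕ φ 𝟘    ≡⟨ cong (_⊕ φ 𝟘) (sym (additive 𝟘 𝟘)) ⟩
    φ (𝟘 ⊕ 𝟘) ⊕ φ 𝟘      ≡⟨ cong (λ z → φ z ⊕ φ 𝟘) (⊕-self 𝟘) ⟩
    φ 𝟘 ⊕ φ 𝟘            ≡⟨ ⊕-self (φ 𝟘) ⟩
    𝟘                    ∎
    where open ≡-Reasoning

  φ-scale : ∀ c v → φ (scale c v) ≡ scale c (φ v)
  φ-scale true v = refl
  φ-scale false v = φ-𝟘

  φ-⨁ : ∀ {N} (g : Fin N → Bits a) → φ (⨁ g) ≡ ⨁ (φ ∘ g)
  φ-⨁ {zero} g = φ-𝟘
  φ-⨁ {suc N} g = trans (additive (g zero) (⨁ (g ∘ suc))) (cong (φ (g zero) ⊕_) (φ-⨁ (g ∘ suc)))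

open IsLinear public

⨁-scale-linear : ∀ {a b} (g : Fin a → Bits b) → IsLinear (λ w → ⨁ (λ x → scale (lookup w x) (g x)))
⨁-scale-linear g = record { additive = λ x y →
  trans (⨁-cong (λ i → trans (cong (λ b → scale b (g i)) (lookup-⊕ x y i)) (scale-xor (lookup x i) (lookup y i) (g i))))
        (⨁-⊕ (λ i → scale (lookup x i) (g i)) (λ i → scale (lookup y i) (g i))) }

Ker : ∀ {a b} (φ : Bits a → Bits b) → Bits a → Set
Ker φ x = φ x ≡ 𝟘

Im : ∀ {a b} (φ : Bits a → Bits b) → Bits b → Set
Im φ y = ∃ λ x → φ x ≡ y

-- Counting subsets of GF(2)^m

χ : ∀ {p} {P : Set p} → Dec P → ℕ
χ (yes _) = 1
χ (no _) = 0

χ-yes : ∀ {p} {P : Set p} (d : Dec P) → P → χ d ≡ 1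
χ-yes (yes _) _ = refl
χ-yes (no ¬p) p = ⊥-elim (¬p p)

χ-no : ∀ {p} {P : Set p} (d : Dec P) → ¬ P → χ d ≡ 0
χ-no (yes p) ¬p = ⊥-elim (¬p p)
χ-no (no _) _ = refl

χ-⊎ : ∀ {p q} {P : Set p} {Q : Set q} (d : Dec P) (d′ : Dec Q) → ¬ (P × Q) → χ (d ⊎-dec d′) ≡ χ d + χ d′
χ-⊎ (yes p) (yes q) disj = ⊥-elim (disj (p , q))
χ-⊎ (yes p) (no ¬q) disj = refl
χ-⊎ (no ¬p) (yes q) disj = refl
χ-⊎ (no ¬p) (no ¬q) disj = refl

χ-≤1 : ∀ {p} {P : Set p} (d : Dec P) → χ d ≤ 1
χ-≤1 (yes _) = ≤-refl
χ-≤1 (no _) = z≤n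

module _ {p q} {P : Set p} {Q : Set q} where

  χ-cong : (d : Dec P) (d′ : Dec Q) → (P → Q) → (Q → P) → χ d ≡ χ d′
  χ-cong (yes p) d′ to from = sym (χ-yes d′ (to p))
  χ-cong (no ¬p) d′ to from = sym (χ-no d′ (¬p ∘ from))

  χ-mono : (d : Dec P) (d′ : Dec Q) → (P → Q) → χ d ≤ χ d′
  χ-mono (yes p) d′ to = ≤-reflexive (sym (χ-yes d′ (to p)))
  χ-mono (no _) d′ to = z≤n

  χ-× : (d : Dec P) (d′ : Dec Q) → χ (d ×-dec d′) ≡ χ d * χ d′
  χ-× (yes p) (yes q) = refl
  χ-× (yes p) (no ¬q) = refl
  χ-× (no ¬p) d′ = refl

∑ : ∀ {m} → (Bits m → ℕ) → ℕ
∑ {zero} f = f []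
∑ {suc m} f = ∑ (λ w → f (false ∷ w)) + ∑ (λ w → f (true ∷ w))

∑-cong : ∀ {m} {f g : Bits m → ℕ} → (∀ w → f w ≡ g w) → ∑ f ≡ ∑ g
∑-cong {zero} p = p []
∑-cong {suc m} p = cong₂ _+_ (∑-cong (λ w → p (false ∷ w))) (∑-cong (λ w → p (true ∷ w)))

∑-mono : ∀ {m} {f g : Bits m → ℕ} → (∀ w → f w ≤ g w) → ∑ f ≤ ∑ g
∑-mono {zero} p = p []
∑-mono {suc m} p = +-mono-≤ (∑-mono (λ w → p (false ∷ w))) (∑-mono (λ w → p (true ∷ w)))

∑-+ : ∀ {m} (f g : Bits m → ℕ) → ∑ (λ w → f w + g w) ≡ ∑ f + ∑ g
∑-+ {zero} f g = refl
∑-+ {suc m} f g = begin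
  ∑ (λ w → f (false ∷ w) + g (false ∷ w)) + ∑ (λ w → f (true ∷ w) + g (true ∷ w))
    ≡⟨ cong₂ _+_ (∑-+ f₀ g₀) (∑-+ f₁ g₁) ⟩
  (∑ f₀ + ∑ g₀) + (∑ f₁ + ∑ g₁)
    ≡⟨ interchange +-commutativeSemigroup (∑ f₀) (∑ g₀) (∑ f₁) (∑ g₁) ⟩
  ∑ f + ∑ g ∎
  where
  f₀ f₁ g₀ g₁ : Bits m → ℕ
  f₀ w = f (false ∷ w)
  f₁ w = f (true ∷ w)
  g₀ w = g (false ∷ w)
  g₁ w = g (true ∷ w)
  open ≡-Reasoning

∑-* : ∀ {m} c (f : Bits m → ℕ) → ∑ (λ w → c * f w) ≡ c * ∑ f
∑-* {zero} c f = refl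
∑-* {suc m} c f =
  trans (cong₂ _+_ (∑-* c (λ w → f (false ∷ w))) (∑-* c (λ w → f (true ∷ w)))) (sym (*-distribˡ-+ c _ _))

∑-const : ∀ {m} c → ∑ {m} (λ _ → c) ≡ c * 2 ^ m
∑-const {zero} c = sym (*-identityʳ c)
∑-const {suc m} c = begin
  ∑ {m} (λ _ → c) + ∑ {m} (λ _ → c)  ≡⟨ cong₂ _+_ (∑-const {m} c) (∑-const {m} c) ⟩
  c * 2 ^ m + c * 2 ^ m              ≡⟨ sym (*-distribˡ-+ c (2 ^ m) (2 ^ m)) ⟩
  c * (2 ^ m + 2 ^ m)                ≡⟨ cong (λ z → c * (2 ^ m + z)) (sym (+-identityʳ (2 ^ m))) ⟩
  c * 2 ^ suc m                      ∎
  where open ≡-Reasoning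

∑-zero : ∀ {m} (f : Bits m → ℕ) → (∀ w → f w ≡ 0) → ∑ f ≡ 0
∑-zero {m} f p = trans (∑-cong p) (∑-const {m} 0)

∑-translate : ∀ {m} (f : Bits m → ℕ) (v : Bits m) → ∑ (λ w → f (w ⊕ v)) ≡ ∑ f
∑-translate {zero} f [] = refl
∑-translate {suc m} f (false ∷ v) =
  cong₂ _+_ (∑-translate (λ w → f (false ∷ w)) v) (∑-translate (λ w → f (true ∷ w)) v)
∑-translate {suc m} f (true ∷ v) =
  trans (cong₂ _+_ (∑-translate (λ w → f (true ∷ w)) v) (∑-translate (λ w → f (false ∷ w)) v))
        (+-comm (∑ (λ w → f (true ∷ w))) (∑ (λ w → f (false ∷ w))))

∑-swap : ∀ {a b} (f : Bits a → Bits b → ℕ) → ∑ (λ x → ∑ (λ y → f x y)) ≡ ∑ (λ y → ∑ (λ x → f x y))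
∑-swap {zero} f = refl
∑-swap {suc a} f =
  trans (cong₂ _+_ (∑-swap (λ x → f (false ∷ x))) (∑-swap (λ x → f (true ∷ x))))
        (sym (∑-+ (λ y → ∑ (λ x → f (false ∷ x) y)) (λ y → ∑ (λ x → f (true ∷ x) y))))

∑-point : ∀ {m} (y₀ : Bits m) (g : Bits m → ℕ) → ∑ (λ y → χ (y ≟ᵛ y₀) * g y) ≡ g y₀
∑-point {zero} [] g = +-identityʳ (g [])
∑-point {suc m} (false ∷ y₀) g =
  trans (cong₂ _+_
    (∑-cong (λ w → cong (_* g (false ∷ w)) (χ-cong ((false ∷ w) ≟ᵛ (false ∷ y₀)) (w ≟ᵛ y₀) ∷-injectiveʳ (cong (false ∷_)))))
    (∑-zero _ (λ w → cong (_* g (true ∷ w)) (χ-no ((true ∷ w) ≟ᵛ (false ∷ y₀)) (λ ())))))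
  (trans (+-identityʳ _) (∑-point y₀ (λ w → g (false ∷ w))))
∑-point {suc m} (true ∷ y₀) g =
  trans (cong₂ _+_
    (∑-zero _ (λ w → cong (_* g (false ∷ w)) (χ-no ((false ∷ w) ≟ᵛ (true ∷ y₀)) (λ ()))))
    (∑-cong (λ w → cong (_* g (true ∷ w)) (χ-cong ((true ∷ w) ≟ᵛ (true ∷ y₀)) (w ≟ᵛ y₀) ∷-injectiveʳ (cong (true ∷_))))))
  (∑-point y₀ (λ w → g (true ∷ w)))

count : ∀ {m p} {P : Bits m → Set p} → (∀ w → Dec (P w)) → ℕ
count P? = ∑ (λ w → χ (P? w))

module _ {m p q} {P : Bits m → Set p} {Q : Bits m → Set q} (P? : ∀ w → Dec (P w)) (Q? : ∀ w → Dec (Q w)) where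

  count-cong : (∀ {w} → P w → Q w) → (∀ {w} → Q w → P w) → count P? ≡ count Q?
  count-cong to from = ∑-cong (λ w → χ-cong (P? w) (Q? w) to from)

  count-mono : (∀ {w} → P w → Q w) → count P? ≤ count Q?
  count-mono to = ∑-mono (λ w → χ-mono (P? w) (Q? w) to)

count-all : ∀ {m} → count {m} {P = λ _ → Unit} (λ _ → yes tt) ≡ 2 ^ m
count-all {m} = trans (∑-const {m} 1) (*-identityˡ _)

count-𝟘 : ∀ {m} → count {m} (_≟ᵛ 𝟘) ≡ 1
count-𝟘 {m} = trans (∑-cong {m} {g = λ w → χ (w ≟ᵛ 𝟘) * 1} (λ w → sym (*-identityʳ _))) (∑-point {m} 𝟘 (λ _ → 1))

∃? : ∀ {m p} {P : Bits m → Set p} → (∀ w → Dec (P w)) → Dec (∃ P)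
∃? {zero} P? with P? []
... | yes p = yes ([] , p)
... | no ¬p = no λ { ([] , p) → ¬p p }
∃? {suc m} P? with ∃? (λ w → P? (false ∷ w)) | ∃? (λ w → P? (true ∷ w))
... | yes (w , p) | _ = yes (false ∷ w , p)
... | no _ | yes (w , p) = yes (true ∷ w , p)
... | no ¬a | no ¬b = no λ { (false ∷ w , p) → ¬a (w , p) ; (true ∷ w , p) → ¬b (w , p) }

Ker? : ∀ {a b} (φ : Bits a → Bits b) x → Dec (Ker φ x)
Ker? φ x = φ x ≟ᵛ 𝟘

Im? : ∀ {a b} (φ : Bits a → Bits b) y → Dec (Im φ y)
Im? φ y = ∃? (λ x → φ x ≟ᵛ y)

module _ {a b} {φ : Bits a → Bits b} (lin : IsLinear φ) where

  -- A nonempty fibre of φ is a translate of Ker φ.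
  fibre-size : ∀ y → ∑ (λ x → χ (φ x ≟ᵛ y)) ≡ χ (Im? φ y) * count (Ker? φ)
  fibre-size y with Im? φ y
  ... | no ¬im = ∑-zero _ (λ x → χ-no (φ x ≟ᵛ y) (λ eq → ¬im (x , eq)))
  ... | yes (x₀ , φx₀≡y) =
    trans (∑-cong (λ x → χ-cong (φ x ≟ᵛ y) (Ker? φ (x ⊕ x₀)) to from))
          (trans (∑-translate (λ x → χ (Ker? φ x)) x₀) (sym (+-identityʳ _)))
    where
    to : ∀ {x} → φ x ≡ y → φ (x ⊕ x₀) ≡ 𝟘
    to {x} eq = trans (additive lin x x₀) (trans (cong₂ _⊕_ eq φx₀≡y) (⊕-self y))
    from : ∀ {x} → φ (x ⊕ x₀) ≡ 𝟘 → φ x ≡ y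
    from {x} eq = trans (⊕≡𝟘⇒≡ (trans (sym (additive lin x x₀)) eq)) φx₀≡y

  count-preimage : ∀ {p} {Z : Bits b → Set p} (Z? : ∀ y → Dec (Z y)) →
                   count (Z? ∘ φ) ≡ count (Ker? φ) * count (λ y → Z? y ×-dec Im? φ y)
  count-preimage Z? = begin
    ∑ (λ x → χ (Z? (φ x)))
      ≡⟨ ∑-cong (λ x → sym (trans (∑-cong (λ y → cong (_* χ (Z? y)) (χ-cong (φ x ≟ᵛ y) (y ≟ᵛ φ x) sym sym)))
                                  (∑-point (φ x) (χ ∘ Z?)))) ⟩
    ∑ (λ x → ∑ (λ y → χ (φ x ≟ᵛ y) * χ (Z? y)))
      ≡⟨ ∑-swap (λ x y → χ (φ x ≟ᵛ y) * χ (Z? y)) ⟩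
    ∑ (λ y → ∑ (λ x → χ (φ x ≟ᵛ y) * χ (Z? y)))
      ≡⟨ ∑-cong (λ y → trans (∑-cong (λ x → *-comm (χ (φ x ≟ᵛ y)) (χ (Z? y))))
                              (∑-* (χ (Z? y)) (λ x → χ (φ x ≟ᵛ y)))) ⟩
    ∑ (λ y → χ (Z? y) * ∑ (λ x → χ (φ x ≟ᵛ y)))
      ≡⟨ ∑-cong (λ y → cong (χ (Z? y) *_) (fibre-size y)) ⟩
    ∑ (λ y → χ (Z? y) * (χ (Im? φ y) * κ))
      ≡⟨ ∑-cong (λ y → trans (sym (*-assoc (χ (Z? y)) _ κ))
                              (trans (cong (_* κ) (sym (χ-× (Z? y) (Im? φ y)))) (*-comm _ κ))) ⟩
    ∑ (λ y → κ * χ (Z? y ×-dec Im? φ y))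
      ≡⟨ ∑-* κ (λ y → χ (Z? y ×-dec Im? φ y)) ⟩
    κ * count (λ y → Z? y ×-dec Im? φ y) ∎
    where
    open ≡-Reasoning
    κ = count (Ker? φ)

  rank-nullity : 2 ^ a ≡ count (Ker? φ) * count (Im? φ)
  rank-nullity = begin
    2 ^ a                                               ≡⟨ sym (count-all {a}) ⟩
    count {a} {P = λ _ → Unit} (λ _ → yes tt)           ≡⟨ count-preimage {Z = λ _ → Unit} (λ _ → yes tt) ⟩
    count (Ker? φ) * count (λ y → yes tt ×-dec Im? φ y) ≡⟨ cong (count (Ker? φ) *_) (count-cong (λ y → yes tt ×-dec Im? φ y) (Im? φ) proj₂ (tt ,_)) ⟩
    count (Ker? φ) * count (Im? φ)                      ∎
    where open ≡-Reasoning

-- Spans and ranks of finite families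

Span : ∀ {m} → List (Bits m) → Bits m → Set
Span [] w = w ≡ 𝟘
Span (v ∷ L) w = Span L w ⊎ Span L (w ⊕ v)

span? : ∀ {m} (L : List (Bits m)) w → Dec (Span L w)
span? [] w = w ≟ᵛ 𝟘
span? (v ∷ L) w = span? L w ⊎-dec span? L (w ⊕ v)

module _ {m : ℕ} where

  span-𝟘 : ∀ (L : List (Bits m)) → Span L 𝟘
  span-𝟘 [] = refl
  span-𝟘 (v ∷ L) = inj₁ (span-𝟘 L)

  span-⊕ : ∀ (L : List (Bits m)) {x y} → Span L x → Span L y → Span L (x ⊕ y)
  span-⊕ [] refl refl = ⊕-self 𝟘
  span-⊕ (v ∷ L) (inj₁ a) (inj₁ b) = inj₁ (span-⊕ L a b)
  span-⊕ (v ∷ L) {x} {y} (inj₁ a) (inj₂ b) = inj₂ (subst (Span L) (sym (⊕-assoc x y v)) (span-⊕ L a b))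
  span-⊕ (v ∷ L) {x} {y} (inj₂ a) (inj₁ b) = inj₂ (subst (Span L) eq (span-⊕ L a b))
    where
    eq : (x ⊕ v) ⊕ y ≡ (x ⊕ y) ⊕ v
    eq = trans (⊕-assoc x v y) (trans (cong (x ⊕_) (⊕-comm v y)) (sym (⊕-assoc x y v)))
  span-⊕ (v ∷ L) {x} {y} (inj₂ a) (inj₂ b) = inj₁ (subst (Span L) eq (span-⊕ L a b))
    where
    eq : (x ⊕ v) ⊕ (y ⊕ v) ≡ x ⊕ y
    eq = trans (⊕-interchange x v y v) (trans (cong ((x ⊕ y) ⊕_) (⊕-self v)) (⊕-identityʳ (x ⊕ y)))

  span-∈ : ∀ (L : List (Bits m)) {v} → v ∈ L → Span L v
  span-∈ (v ∷ L) (here refl) = inj₂ (subst (Span L) (sym (⊕-self v)) (span-𝟘 L))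
  span-∈ (u ∷ L) (there p) = inj₁ (span-∈ L p)

  span-ind : ∀ (L : List (Bits m)) (P : Bits m → Set) → P 𝟘 → (∀ {x y} → P x → P y → P (x ⊕ y)) →
             (∀ {v} → v ∈ L → P v) → ∀ {w} → Span L w → P w
  span-ind [] P p𝟘 p⊕ pL refl = p𝟘
  span-ind (v ∷ L) P p𝟘 p⊕ pL (inj₁ s) = span-ind L P p𝟘 p⊕ (pL ∘ there) s
  span-ind (v ∷ L) P p𝟘 p⊕ pL {w} (inj₂ s) =
    subst P (⊕-cancelʳ w v) (p⊕ (span-ind L P p𝟘 p⊕ (pL ∘ there) s) (pL (here refl)))

  span-⊆ : ∀ (L L′ : List (Bits m)) → (∀ {v} → v ∈ L → Span L′ v) → ∀ {w} → Span L w → Span L′ w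
  span-⊆ L L′ = span-ind L (Span L′) (span-𝟘 L′) (span-⊕ L′)

  span-scale : ∀ (L : List (Bits m)) c {v} → Span L v → Span L (scale c v)
  span-scale L true s = s
  span-scale L false s = span-𝟘 L

  span-⨁ : ∀ {N} (L : List (Bits m)) (g : Fin N → Bits m) → (∀ i → Span L (g i)) → Span L (⨁ g)
  span-⨁ {zero} L g p = span-𝟘 L
  span-⨁ {suc N} L g p = span-⊕ L (p zero) (span-⨁ L (g ∘ suc) (p ∘ suc))

  span-linear : ∀ {N} (L : List (Bits m)) {φ : Bits N → Bits m} → IsLinear φ →
                (∀ i → Span L (φ (e i))) → ∀ w → Span L (φ w)
  span-linear L {φ} lin h w =
    subst (Span L) (trans (sym (φ-⨁ lin (λ x → scale (lookup w x) (e x)))) (cong φ (⨁-basis w)))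
      (span-⨁ L _ (λ i → subst (Span L) (sym (φ-scale lin (lookup w i) (e i))) (span-scale L (lookup w i) (h i))))

rk : ∀ {m} → List (Bits m) → ℕ
rk [] = 0
rk (v ∷ L) = χ (¬? (span? L v)) + rk L

module _ {m : ℕ} (L : List (Bits m)) {v : Bits m} where

  span-∷-redundant : Span L v → ∀ {w} → Span (v ∷ L) w → Span L w
  span-∷-redundant sv (inj₁ s) = s
  span-∷-redundant sv {w} (inj₂ s) = subst (Span L) (⊕-cancelʳ w v) (span-⊕ L s sv)

  span-∷-disjoint : ¬ Span L v → ∀ {w} → ¬ (Span L w × Span L (w ⊕ v))
  span-∷-disjoint ¬sv {w} (s , s′) = ¬sv (subst (Span L) (⊕-cancelˡ w v) (span-⊕ L s s′))

count-span : ∀ {m} (L : List (Bits m)) → count (span? L) ≡ 2 ^ rk L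
count-span {m} [] = count-𝟘 {m}
count-span (v ∷ L) with span? L v
... | yes sv = begin
  count (span? (v ∷ L))  ≡⟨ count-cong (span? (v ∷ L)) (span? L) (span-∷-redundant L sv) inj₁ ⟩
  count (span? L)        ≡⟨ count-span L ⟩
  2 ^ rk L               ∎
  where open ≡-Reasoning
... | no ¬sv = begin
  count (span? (v ∷ L))
    ≡⟨ ∑-cong (λ w → χ-⊎ (span? L w) (span? L (w ⊕ v)) (span-∷-disjoint L ¬sv)) ⟩
  ∑ (λ w → χ (span? L w) + χ (span? L (w ⊕ v)))
    ≡⟨ ∑-+ (χ ∘ span? L) (λ w → χ (span? L (w ⊕ v))) ⟩
  count (span? L) + ∑ (λ w → χ (span? L (w ⊕ v)))
    ≡⟨ cong (count (span? L) +_) (∑-translate (χ ∘ span? L) v) ⟩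
  count (span? L) + count (span? L)
    ≡⟨ cong₂ _+_ (count-span L) (trans (count-span L) (sym (+-identityʳ _))) ⟩
  2 ^ (1 + rk L) ∎
  where open ≡-Reasoning

2^-cancel-≤ : ∀ a b → 2 ^ a ≤ 2 ^ b → a ≤ b
2^-cancel-≤ a b le with a ≤? b
... | yes a≤b = a≤b
... | no a≰b = ⊥-elim (<⇒≱ (^-monoʳ-< 2 (s≤s (s≤s z≤n)) (≰⇒> a≰b)) le)

2^-injective : ∀ {a b} → 2 ^ a ≡ 2 ^ b → a ≡ b
2^-injective {a} {b} eq = ≤-antisym (2^-cancel-≤ a b (≤-reflexive eq)) (2^-cancel-≤ b a (≤-reflexive (sym eq)))

m*m≡n*n⇒m≡n : ∀ {m n} → m * m ≡ n * n → m ≡ n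
m*m≡n*n⇒m≡n {m} {n} eq with <-cmp m n
... | tri< m<n _ _ = ⊥-elim (<-irrefl eq (*-mono-< m<n m<n))
... | tri≈ _ m≡n _ = m≡n
... | tri> _ _ n<m = ⊥-elim (<-irrefl (sym eq) (*-mono-< n<m n<m))

module _ {m : ℕ} where

  rk-mono : ∀ (L L′ : List (Bits m)) → (∀ {v} → v ∈ L → Span L′ v) → rk L ≤ rk L′
  rk-mono L L′ L⊆L′ = 2^-cancel-≤ (rk L) (rk L′)
    (subst₂ _≤_ (count-span L) (count-span L′) (count-mono (span? L) (span? L′) (span-⊆ L L′ L⊆L′)))

  rk-equiv : ∀ (L L′ : List (Bits m)) → (∀ {v} → v ∈ L → Span L′ v) → (∀ {v} → v ∈ L′ → Span L v) → rk L ≡ rk L′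
  rk-equiv L L′ L⊆L′ L′⊆L = ≤-antisym (rk-mono L L′ L⊆L′) (rk-mono L′ L L′⊆L)

  rk-++-≤ : ∀ (L K : List (Bits m)) → rk (L ++ K) ≤ length L + rk K
  rk-++-≤ [] K = ≤-refl
  rk-++-≤ (v ∷ L) K = +-mono-≤ (χ-≤1 (¬? (span? (L ++ K) v))) (rk-++-≤ L K)

  rk-++-≥ : ∀ (L K : List (Bits m)) → rk K ≤ rk (L ++ K)
  rk-++-≥ [] K = ≤-refl
  rk-++-≥ (v ∷ L) K = ≤-trans (rk-++-≥ L K) (m≤n+m _ _)

  rk-submodular : ∀ (as bs cs : List (Bits m)) → rk (as ++ bs ++ cs) + rk cs ≤ rk (as ++ cs) + rk (bs ++ cs)
  rk-submodular [] bs cs = ≤-reflexive (+-comm (rk (bs ++ cs)) (rk cs))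
  rk-submodular (a ∷ as) bs cs = begin
    (new₁ + rk (as ++ bs ++ cs)) + rk cs  ≡⟨ +-assoc new₁ _ _ ⟩
    new₁ + (rk (as ++ bs ++ cs) + rk cs)  ≤⟨ +-mono-≤ new₁≤new₂ (rk-submodular as bs cs) ⟩
    new₂ + (rk (as ++ cs) + rk (bs ++ cs)) ≡⟨ sym (+-assoc new₂ _ _) ⟩
    (new₂ + rk (as ++ cs)) + rk (bs ++ cs) ∎
    where
    open ≤-Reasoning
    new₁ = χ (¬? (span? (as ++ bs ++ cs) a))
    new₂ = χ (¬? (span? (as ++ cs) a))
    as++cs⊆ : ∀ {v} → v ∈ as ++ cs → Span (as ++ bs ++ cs) v
    as++cs⊆ p with ∈-++⁻ as p
    ... | inj₁ q = span-∈ (as ++ bs ++ cs) (∈-++⁺ˡ q)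
    ... | inj₂ q = span-∈ (as ++ bs ++ cs) (∈-++⁺ʳ as (∈-++⁺ʳ bs q))
    new₁≤new₂ : new₁ ≤ new₂
    new₁≤new₂ = χ-mono (¬? (span? (as ++ bs ++ cs) a)) (¬? (span? (as ++ cs) a))
                  (λ ∉ ∈ → ∉ (span-⊆ (as ++ cs) (as ++ bs ++ cs) as++cs⊆ ∈))

-- Contracted linear matroids

select : ∀ {N m} → (Fin N → Bits m) → Subset N → List (Bits m)
select {zero} vec [] = []
select {suc N} vec (true ∷ X) = vec zero ∷ select (vec ∘ suc) X
select {suc N} vec (false ∷ X) = select (vec ∘ suc) X

length-select : ∀ {N m} (vec : Fin N → Bits m) X → length (select vec X) ≡ ∣ X ∣
length-select {zero} vec [] = refl
length-select {suc N} vec (true ∷ X) = cong suc (length-select (vec ∘ suc) X)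
length-select {suc N} vec (false ∷ X) = length-select (vec ∘ suc) X

∈-select⁻ : ∀ {N m} (vec : Fin N → Bits m) X {y} → y ∈ select vec X → ∃ λ i → i ∈ˢ X × y ≡ vec i
∈-select⁻ {suc N} vec (true ∷ X) (here refl) = zero , hereˢ , refl
∈-select⁻ {suc N} vec (true ∷ X) (there p) with ∈-select⁻ (vec ∘ suc) X p
... | i , i∈X , eq = suc i , thereˢ i∈X , eq
∈-select⁻ {suc N} vec (false ∷ X) p with ∈-select⁻ (vec ∘ suc) X p
... | i , i∈X , eq = suc i , thereˢ i∈X , eq

∈-select⁺ : ∀ {N m} (vec : Fin N → Bits m) X {i} → i ∈ˢ X → vec i ∈ select vec X
∈-select⁺ {suc N} vec (true ∷ X) hereˢ = here refl
∈-select⁺ {suc N} vec (true ∷ X) (thereˢ i∈X) = there (∈-select⁺ (vec ∘ suc) X i∈X)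
∈-select⁺ {suc N} vec (false ∷ X) (thereˢ i∈X) = ∈-select⁺ (vec ∘ suc) X i∈X

∸-submodular : ∀ {k a b c d} → k ≤ a → k ≤ b → k ≤ c → k ≤ d →
               a + b ≤ c + d → (a ∸ k) + (b ∸ k) ≤ (c ∸ k) + (d ∸ k)
∸-submodular {k} {a} {b} {c} {d} k≤a k≤b k≤c k≤d le =
  +-cancelʳ-≤ (k + k) _ _ (subst₂ _≤_ (sym (restore k≤a k≤b)) (sym (restore k≤c k≤d)) le)
  where
  restore : ∀ {x y} → k ≤ x → k ≤ y → (x ∸ k) + (y ∸ k) + (k + k) ≡ x + y
  restore {x} {y} k≤x k≤y = begin
    (x ∸ k) + (y ∸ k) + (k + k)  ≡⟨ interchange +-commutativeSemigroup (x ∸ k) (y ∸ k) k k ⟩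
    ((x ∸ k) + k) + ((y ∸ k) + k) ≡⟨ cong₂ _+_ (m∸n+n≡m k≤x) (m∸n+n≡m k≤y) ⟩
    x + y                        ∎
    where open ≡-Reasoning

module Contraction {N m : ℕ} (vec : Fin N → Bits m) (K : List (Bits m)) where

  family : Subset N → List (Bits m)
  family X = select vec X ++ K

  rank : Subset N → ℕ
  rank X = rk (family X) ∸ rk K

  family-mono : ∀ {X Y} → X ⊆ Y → ∀ {v} → v ∈ family X → Span (family Y) v
  family-mono {X} {Y} X⊆Y p with ∈-++⁻ (select vec X) p
  ... | inj₂ q = span-∈ (family Y) (∈-++⁺ʳ (select vec Y) q)
  ... | inj₁ q with ∈-select⁻ vec X q
  ... | i , i∈X , refl = span-∈ (family Y) (∈-++⁺ˡ (∈-select⁺ vec Y (X⊆Y i∈X)))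

  rk-K≤ : ∀ X → rk K ≤ rk (family X)
  rk-K≤ X = rk-++-≥ (select vec X) K

  rk-family-∪ : ∀ X Y → rk (select vec X ++ select vec Y ++ family (X ∩ Y)) ≡ rk (family (X ∪ Y))
  rk-family-∪ X Y = rk-equiv _ _ to from
    where
    to : ∀ {v} → v ∈ select vec X ++ select vec Y ++ family (X ∩ Y) → Span (family (X ∪ Y)) v
    to p with ∈-++⁻ (select vec X) p
    ... | inj₁ q = family-mono (λ i∈X → x∈p∪q⁺ (inj₁ i∈X)) (∈-++⁺ˡ q)
    ... | inj₂ q with ∈-++⁻ (select vec Y) q
    ... | inj₁ r = family-mono (λ i∈Y → x∈p∪q⁺ (inj₂ i∈Y)) (∈-++⁺ˡ r)
    ... | inj₂ r = family-mono (λ i∈X∩Y → x∈p∪q⁺ (inj₁ (proj₁ (x∈p∩q⁻ X Y i∈X∩Y)))) r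
    from : ∀ {v} → v ∈ family (X ∪ Y) → Span (select vec X ++ select vec Y ++ family (X ∩ Y)) v
    from p with ∈-++⁻ (select vec (X ∪ Y)) p
    ... | inj₂ q = span-∈ _ (∈-++⁺ʳ (select vec X) (∈-++⁺ʳ (select vec Y) (∈-++⁺ʳ (select vec (X ∩ Y)) q)))
    ... | inj₁ q with ∈-select⁻ vec (X ∪ Y) q
    ... | i , i∈X∪Y , refl with x∈p∪q⁻ X Y i∈X∪Y
    ... | inj₁ i∈X = span-∈ _ (∈-++⁺ˡ (∈-select⁺ vec X i∈X))
    ... | inj₂ i∈Y = span-∈ _ (∈-++⁺ʳ (select vec X) (∈-++⁺ˡ (∈-select⁺ vec Y i∈Y)))

  rk-family-absorb : ∀ {X W} → W ⊆ X → rk (select vec X ++ family W) ≡ rk (family X)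
  rk-family-absorb {X} {W} W⊆X = rk-equiv _ _ to from
    where
    to : ∀ {v} → v ∈ select vec X ++ family W → Span (family X) v
    to p with ∈-++⁻ (select vec X) p
    ... | inj₁ q = span-∈ (family X) (∈-++⁺ˡ q)
    ... | inj₂ q = family-mono W⊆X q
    from : ∀ {v} → v ∈ family X → Span (select vec X ++ family W) v
    from p with ∈-++⁻ (select vec X) p
    ... | inj₁ q = span-∈ _ (∈-++⁺ˡ q)
    ... | inj₂ q = span-∈ _ (∈-++⁺ʳ (select vec X) (∈-++⁺ʳ (select vec W) q))

  rk-family-submodular : ∀ X Y → rk (family (X ∪ Y)) + rk (family (X ∩ Y)) ≤ rk (family X) + rk (family Y)
  rk-family-submodular X Y =
    subst₂ _≤_ (cong (_+ rk (family (X ∩ Y))) (rk-family-∪ X Y))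
               (cong₂ _+_ (rk-family-absorb (proj₁ ∘ x∈p∩q⁻ X Y)) (rk-family-absorb (proj₂ ∘ x∈p∩q⁻ X Y)))
               (rk-submodular (select vec X) (select vec Y) (family (X ∩ Y)))

  matroid : Matroid N
  matroid = record
    { rank = rank
    ; rank-card = λ X → m≤n+o⇒m∸n≤o (rk (family X)) (rk K)
        (subst (rk (family X) ≤_) (trans (cong (_+ rk K) (length-select vec X)) (+-comm ∣ X ∣ (rk K)))
               (rk-++-≤ (select vec X) K))
    ; rank-mono = λ X⊆Y → ∸-monoˡ-≤ (rk K) (rk-mono _ _ (family-mono X⊆Y))
    ; rank-sub = λ X Y → ∸-submodular (rk-K≤ (X ∪ Y)) (rk-K≤ (X ∩ Y)) (rk-K≤ X) (rk-K≤ Y) (rk-family-submodular X Y)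
    }

-- Families spanning the vectors with zero sum on each class of a partition

Linked : ∀ {m} → List (Bits m) → Fin m → Fin m → Set
Linked L x y = Span L (e x ⊕ e y)

module _ {m : ℕ} (L : List (Bits m)) where

  linked-refl : ∀ x → Linked L x x
  linked-refl x = subst (Span L) (sym (⊕-self (e x))) (span-𝟘 L)

  linked-sym : ∀ {x y} → Linked L x y → Linked L y x
  linked-sym {x} {y} = subst (Span L) (⊕-comm (e x) (e y))

  linked-trans : ∀ {x y z} → Linked L x y → Linked L y z → Linked L x z
  linked-trans {x} {y} {z} p q = subst (Span L) eq (span-⊕ L p q)
    where
    eq : (e x ⊕ e y) ⊕ (e y ⊕ e z) ≡ e x ⊕ e z
    eq = trans (sym (⊕-assoc (e x ⊕ e y) (e y) (e z))) (cong (_⊕ e z) (⊕-cancelʳ (e x) (e y)))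

module Partition {N k : ℕ} (f : Fin N → Fin k) (rep : Fin k → Fin N) (f∘rep : ∀ j → f (rep j) ≡ j) where

  collapse : Bits N → Bits k
  collapse w = ⨁ (λ x → scale (lookup w x) (e (f x)))

  spread : Bits k → Bits N
  spread y = ⨁ (λ j → scale (lookup y j) (e (rep j)))

  collapse-linear : IsLinear collapse
  collapse-linear = ⨁-scale-linear (e ∘ f)

  spread-linear : IsLinear spread
  spread-linear = ⨁-scale-linear (e ∘ rep)

  collapse-e : ∀ x → collapse (e x) ≡ e (f x)
  collapse-e x = ⨁-select x (e ∘ f)

  collapse-link : ∀ {x y} → f x ≡ f y → collapse (e x ⊕ e y) ≡ 𝟘
  collapse-link {x} {y} fx≡fy = begin
    collapse (e x ⊕ e y)        ≡⟨ additive collapse-linear (e x) (e y) ⟩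
    collapse (e x) ⊕ collapse (e y) ≡⟨ cong₂ _⊕_ (collapse-e x) (collapse-e y) ⟩
    e (f x) ⊕ e (f y)           ≡⟨ cong (λ z → e (f x) ⊕ e z) (sym fx≡fy) ⟩
    e (f x) ⊕ e (f x)           ≡⟨ ⊕-self _ ⟩
    𝟘                           ∎
    where open ≡-Reasoning

  collapse∘spread : ∀ y → collapse (spread y) ≡ y
  collapse∘spread y = begin
    collapse (⨁ (λ j → scale (lookup y j) (e (rep j))))
      ≡⟨ φ-⨁ collapse-linear (λ j → scale (lookup y j) (e (rep j))) ⟩
    ⨁ (λ j → collapse (scale (lookup y j) (e (rep j))))
      ≡⟨ ⨁-cong (λ j → trans (φ-scale collapse-linear (lookup y j) (e (rep j)))
                             (cong (scale (lookup y j)) (trans (collapse-e (rep j)) (cong e (f∘rep j))))) ⟩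
    ⨁ (λ j → scale (lookup y j) (e j))
      ≡⟨ ⨁-basis y ⟩
    y ∎
    where open ≡-Reasoning

  -- w is the sum of the links e x ⊕ e (rep (f x)) over its support,
  -- because the correction ⨁ e (rep (f x)) is spread (collapse w).
  ker⊆span : ∀ (L : List (Bits N)) → (∀ {x y} → f x ≡ f y → Linked L x y) →
             ∀ {w} → collapse w ≡ 𝟘 → Span L w
  ker⊆span L links {w} collapse-w≡𝟘 = subst (Span L) sum≡w (span-⊕ L span-links (subst (Span L) (sym correction≡𝟘) (span-𝟘 L)))
    where
    r : Fin N → Fin N
    r x = rep (f x)
    span-links : Span L (⨁ (λ x → scale (lookup w x) (e x ⊕ e (r x))))
    span-links = span-⨁ L _ (λ x → span-scale L (lookup w x) (links (sym (f∘rep (f x)))))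
    correction≡𝟘 : ⨁ (λ x → scale (lookup w x) (e (r x))) ≡ 𝟘
    correction≡𝟘 = begin
      ⨁ (λ x → scale (lookup w x) (e (r x)))
        ≡⟨ ⨁-cong (λ x → cong (scale (lookup w x)) (sym (⨁-select (f x) (e ∘ rep)))) ⟩
      ⨁ (λ x → scale (lookup w x) (spread (e (f x))))
        ≡⟨ ⨁-cong (λ x → sym (φ-scale spread-linear (lookup w x) (e (f x)))) ⟩
      ⨁ (λ x → spread (scale (lookup w x) (e (f x))))
        ≡⟨ sym (φ-⨁ spread-linear (λ x → scale (lookup w x) (e (f x)))) ⟩
      spread (collapse w)
        ≡⟨ cong spread collapse-w≡𝟘 ⟩
      spread 𝟘
        ≡⟨ φ-𝟘 spread-linear ⟩
      𝟘 ∎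
      where open ≡-Reasoning
    sum≡w : ⨁ (λ x → scale (lookup w x) (e x ⊕ e (r x))) ⊕ ⨁ (λ x → scale (lookup w x) (e (r x))) ≡ w
    sum≡w = begin
      ⨁ (λ x → scale (lookup w x) (e x ⊕ e (r x))) ⊕ ⨁ (λ x → scale (lookup w x) (e (r x)))
        ≡⟨ sym (⨁-⊕ (λ x → scale (lookup w x) (e x ⊕ e (r x))) (λ x → scale (lookup w x) (e (r x)))) ⟩
      ⨁ (λ x → scale (lookup w x) (e x ⊕ e (r x)) ⊕ scale (lookup w x) (e (r x)))
        ≡⟨ ⨁-cong (λ x → trans (sym (scale-⊕ (lookup w x) (e x ⊕ e (r x)) (e (r x))))
                              (cong (scale (lookup w x)) (⊕-cancelʳ (e x) (e (r x))))) ⟩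
      ⨁ (λ x → scale (lookup w x) (e x))
        ≡⟨ ⨁-basis w ⟩
      w ∎
      where open ≡-Reasoning

  -- A family inside Ker collapse that links every class spans Ker collapse,
  -- which has dimension N - k since collapse is onto.
  rk-partition : ∀ (L : List (Bits N)) → (∀ {v} → v ∈ L → collapse v ≡ 𝟘) →
                 (∀ {x y} → f x ≡ f y → Linked L x y) → rk L + k ≡ N
  rk-partition L L⊆ker links = 2^-injective (begin
    2 ^ (rk L + k)                      ≡⟨ ^-distribˡ-+-* 2 (rk L) k ⟩
    2 ^ rk L * 2 ^ k                    ≡⟨ cong₂ _*_ (sym (count-span L)) (sym (count-all {k})) ⟩
    count (span? L) * count {k} {P = λ _ → Unit} (λ _ → yes tt)
      ≡⟨ cong₂ _*_ (count-cong (span? L) (Ker? collapse) span⊆ker (ker⊆span L links))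
                   (count-cong (λ _ → yes tt) (Im? collapse) (λ {y} _ → spread y , collapse∘spread y) (λ _ → tt)) ⟩
    count (Ker? collapse) * count (Im? collapse)
      ≡⟨ sym (rank-nullity collapse-linear) ⟩
    2 ^ N ∎)
    where
    open ≡-Reasoning
    span⊆ker : ∀ {w} → Span L w → collapse w ≡ 𝟘
    span⊆ker = span-ind L (λ w → collapse w ≡ 𝟘) (φ-𝟘 collapse-linear)
                 (λ {x} {y} p q → trans (additive collapse-linear x y) (trans (cong₂ _⊕_ p q) (⊕-self 𝟘))) L⊆ker

-- Connected components of a finite multigraph given by its list of edges

EdgeIn : ∀ {n} → List (Fin n × Fin n) → Fin n → Fin n → Set
EdgeIn es u w = Any (λ (a , b) → (u ≡ a × w ≡ b) ⊎ (u ≡ b × w ≡ a)) es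

Labelling : ∀ {n} → (Fin n → Fin n → Set) → ℕ → Set
Labelling {n} R k = Σ (Fin n → Fin k) λ f → (∀ y → ∃ λ x → f x ≡ y) × (∀ u w → (f u ≡ f w) ⇔ Star R u w)

-- Relabel Fin (suc k) → Fin k by identifying the label b with a ≢ b.
module Identify {k : ℕ} (a b : Fin (suc k)) (a≢b : a ≢ b) where

  redirect : Fin (suc k) → Fin (suc k)
  redirect x with x ≟ᶠ b
  ... | yes _ = a
  ... | no _ = x

  b≢redirect : ∀ x → b ≢ redirect x
  b≢redirect x with x ≟ᶠ b
  ... | yes _ = a≢b ∘ sym
  ... | no x≢b = x≢b ∘ sym

  redirect-b : redirect b ≡ a
  redirect-b with b ≟ᶠ b
  ... | yes _ = refl
  ... | no b≢b = ⊥-elim (b≢b refl)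

  redirect-≢b : ∀ {x} → x ≢ b → redirect x ≡ x
  redirect-≢b {x} x≢b with x ≟ᶠ b
  ... | yes x≡b = ⊥-elim (x≢b x≡b)
  ... | no _ = refl

  identify : Fin (suc k) → Fin k
  identify x = punchOut (b≢redirect x)

  identify-a≡identify-b : identify a ≡ identify b
  identify-a≡identify-b = punchOut-cong b (trans (redirect-≢b a≢b) (sym redirect-b))

  identify-injective : ∀ {x y} → identify x ≡ identify y → redirect x ≡ redirect y
  identify-injective {x} {y} = punchOut-injective (b≢redirect x) (b≢redirect y)

  identify-punchIn : ∀ y → identify (punchIn b y) ≡ y
  identify-punchIn y = trans (punchOut-cong b (redirect-≢b (punchInᵢ≢i b y))) (punchOut-punchIn b)

  identify-≡ : ∀ {x y} → identify x ≡ identify y → x ≡ y ⊎ (x ≡ a × y ≡ b) ⊎ (x ≡ b × y ≡ a)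
  identify-≡ {x} {y} eq = cases (x ≟ᶠ b) (y ≟ᶠ b)
    where
    r = identify-injective {x} {y} eq
    cases : Dec (x ≡ b) → Dec (y ≡ b) → x ≡ y ⊎ (x ≡ a × y ≡ b) ⊎ (x ≡ b × y ≡ a)
    cases (yes x≡b) (yes y≡b) = inj₁ (trans x≡b (sym y≡b))
    cases (yes x≡b) (no y≢b) = inj₂ (inj₂ (x≡b , trans (sym (redirect-≢b y≢b)) (trans (sym r) (trans (cong redirect x≡b) redirect-b))))
    cases (no x≢b) (yes y≡b) = inj₂ (inj₁ (trans (sym (redirect-≢b x≢b)) (trans r (trans (cong redirect y≡b) redirect-b)) , y≡b))
    cases (no x≢b) (no y≢b) = inj₁ (trans (sym (redirect-≢b x≢b)) (trans r (redirect-≢b y≢b)))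

components : ∀ {n} (es : List (Fin n × Fin n)) → ∃ λ k → Labelling (EdgeIn es) k
components {n} [] = n , id , (λ y → y , refl) , λ u w → mk⇔ (λ { refl → ε }) discrete
  where
  discrete : ∀ {u w} → Star (EdgeIn []) u w → u ≡ w
  discrete ε = refl
  discrete (() ◅ _)
components {n} ((a , b) ∷ es) with components es
... | k , f , f-onto , f⇔ with f a ≟ᶠ f b
...   | yes fa≡fb = k , f , f-onto , λ u w → mk⇔ (star-map there ∘ Equivalence.to (f⇔ u w)) respects
  where
  respects : ∀ {u w} → Star (EdgeIn ((a , b) ∷ es)) u w → f u ≡ f w
  respects ε = refl
  respects (here (inj₁ (refl , refl)) ◅ rs) = trans fa≡fb (respects rs)
  respects (here (inj₂ (refl , refl)) ◅ rs) = trans (sym fa≡fb) (respects rs)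
  respects {u} (_◅_ {j = v} (there e) rs) = trans (Equivalence.from (f⇔ u v) (e ◅ ε)) (respects rs)
...   | no fa≢fb = merge k f f-onto f⇔ fa≢fb
  where
  R = EdgeIn ((a , b) ∷ es)
  old : ∀ {u w} → Star (EdgeIn es) u w → Star R u w
  old = star-map there
  merge : ∀ k (f : Fin n → Fin k) → (∀ y → ∃ λ x → f x ≡ y) → (∀ u w → (f u ≡ f w) ⇔ Star (EdgeIn es) u w) →
          f a ≢ f b → ∃ λ k → Labelling R k
  merge zero f _ _ _ with () ← f a
  merge (suc k′) f f-onto f⇔ fa≢fb = k′ , identify ∘ f , onto , λ u w → mk⇔ (to u w) respects
    where
    open Identify (f a) (f b) fa≢fb
    path : ∀ u w → f u ≡ f w → Star R u w
    path u w = old ∘ Equivalence.to (f⇔ u w)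
    onto : ∀ y → ∃ λ x → identify (f x) ≡ y
    onto y with f-onto (punchIn (f b) y)
    ... | x , eq = x , trans (cong identify eq) (identify-punchIn y)
    to : ∀ u w → identify (f u) ≡ identify (f w) → Star R u w
    to u w eq with identify-≡ eq
    ... | inj₁ same = path u w same
    ... | inj₂ (inj₁ (fu≡fa , fw≡fb)) = path u a fu≡fa ◅◅ (here (inj₁ (refl , refl)) ◅ ε) ◅◅ path b w (sym fw≡fb)
    ... | inj₂ (inj₂ (fu≡fb , fw≡fa)) = path u b fu≡fb ◅◅ (here (inj₂ (refl , refl)) ◅ ε) ◅◅ path a w (sym fw≡fa)
    respects : ∀ {u w} → Star R u w → identify (f u) ≡ identify (f w)
    respects ε = refl
    respects (here (inj₁ (refl , refl)) ◅ rs) = trans identify-a≡identify-b (respects rs)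
    respects (here (inj₂ (refl , refl)) ◅ rs) = trans (sym identify-a≡identify-b) (respects rs)
    respects {u} (_◅_ {j = v} (there e) rs) = trans (cong identify (Equivalence.from (f⇔ u v) (e ◅ ε))) (respects rs)

[_≟_] : ∀ {k} → Fin k → Fin k → Bool
[ a ≟ b ] = does (a ≟ᶠ b)

-- a slot in the pair of t not containing slot 0
other : Fin 3 → Fin 4
other zero = suc (suc zero)
other (suc zero) = suc zero
other (suc (suc zero)) = suc zero

inOtherPair : Fin 3 → Fin 4 → Bool
inOtherPair t a = not ([ a ≟ zero ] ∨ [ a ≟ mate t zero ])

mate-involutive : ∀ t a → mate t (mate t a) ≡ a
mate-involutive = toWitness {a? = all? λ t → all? λ a → mate t (mate t a) ≟ᶠ a} tt

mate-surjective : ∀ a b → a ≢ b → ∃ λ t → mate t a ≡ b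
mate-surjective = toWitness {a? = all? λ a → all? λ b → ¬? (a ≟ᶠ b) →-dec any? λ t → mate t a ≟ᶠ b} tt

mate-remaining : ∀ t a b y → b ≢ a → b ≢ mate t a → y ≢ a → y ≢ mate t a → y ≢ b → y ≡ mate t b
mate-remaining = toWitness {a? = all? λ t → all? λ a → all? λ b → all? λ y →
  ¬? (b ≟ᶠ a) →-dec ¬? (b ≟ᶠ mate t a) →-dec ¬? (y ≟ᶠ a) →-dec ¬? (y ≟ᶠ mate t a) →-dec ¬? (y ≟ᶠ b) →-dec
  (y ≟ᶠ mate t b)} tt

pairs-cover : ∀ t b → ([ zero ≟ b ] xor [ mate t zero ≟ b ]) xor ([ other t ≟ b ] xor [ mate t (other t) ≟ b ]) ≡ true
pairs-cover = toWitness {a? = all? λ t → all? λ b →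
  (([ zero ≟ b ] xor [ mate t zero ≟ b ]) xor ([ other t ≟ b ] xor [ mate t (other t) ≟ b ])) ≟ᵇ true} tt

pair-vs-first : ∀ t a b → [ a ≟ b ] xor [ mate t a ≟ b ] ≡ ([ zero ≟ b ] xor [ mate t zero ≟ b ]) xor inOtherPair t a
pair-vs-first = toWitness {a? = all? λ t → all? λ a → all? λ b →
  ([ a ≟ b ] xor [ mate t a ≟ b ]) ≟ᵇ (([ zero ≟ b ] xor [ mate t zero ≟ b ]) xor inOtherPair t a)} tt

-- The vector representation of the transitions of F

module TransitionMatroid {n : ℕ} (F : FourRegular n) where

  M : ℕ
  M = n * 4

  H : Set
  H = HalfEdge n

  idx : H → Fin M
  idx (v , a) = combine v a

  unidx : Fin M → H
  unidx = remQuot 4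

  unidx∘idx : ∀ h → unidx (idx h) ≡ h
  unidx∘idx (v , a) = remQuot-combine v a

  idx∘unidx : ∀ i → idx (unidx i) ≡ i
  idx∘unidx i = combine-remQuot {n} 4 i

  idx-injective : ∀ {h h′} → idx h ≡ idx h′ → h ≡ h′
  idx-injective {h} {h′} eq = trans (sym (unidx∘idx h)) (trans (cong unidx eq) (unidx∘idx h′))

  σᶠ : Fin M → Fin M
  σᶠ i = idx (σ F (unidx i))

  σᶠ-idx : ∀ h → σᶠ (idx h) ≡ idx (σ F h)
  σᶠ-idx h = cong (idx ∘ σ F) (unidx∘idx h)

  σᶠ-involutive : ∀ i → σᶠ (σᶠ i) ≡ i
  σᶠ-involutive i = trans (σᶠ-idx (σ F (unidx i))) (trans (cong idx (σ-invol F (unidx i))) (idx∘unidx i))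

  σᶠ-irreflexive : ∀ i → σᶠ i ≢ i
  σᶠ-irreflexive i eq = σ-fpf F (unidx i) (trans (sym (unidx∘idx _)) (cong unidx eq))

  vtx : Fin M → Fin n
  vtx i = vertex (unidx i)

  vtx-idx : ∀ h → vtx (idx h) ≡ vertex h
  vtx-idx h = cong proj₁ (unidx∘idx h)

  E : H → Bits M
  E h = e (idx h)

  lift : Bits n → Bits M
  lift b = tabulate (λ i → lookup b (vtx i))

  vertexVec : Fin n → Bits M
  vertexVec v = lift (e v)

  edgeVec : Fin M → Bits M
  edgeVec i = e i ⊕ e (σᶠ i)

  pairVec : Fin n → Fin 3 → Fin 4 → Bits M
  pairVec v t a = E (v , a) ⊕ E (v , mate t a)

  transitionVec : Fin (n * 3) → Bits M
  transitionVec g = pairVec (proj₁ (remQuot {n} 3 g)) (proj₂ (remQuot {n} 3 g)) zero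

  transitionVec-combine : ∀ v t → transitionVec (combine v t) ≡ pairVec v t zero
  transitionVec-combine v t = cong (λ q → pairVec (proj₁ q) (proj₂ q) zero) (remQuot-combine {n} {3} v t)

  K : List (Bits M)
  K = List.tabulate edgeVec ++ List.tabulate vertexVec

  open Contraction transitionVec K public using (matroid; rank; family; rk-K≤)

  edgeVec∈K : ∀ i → edgeVec i ∈ K
  edgeVec∈K i = ∈-++⁺ˡ (∈-tabulate⁺ i)

  vertexVec∈K : ∀ v → vertexVec v ∈ K
  vertexVec∈K v = ∈-++⁺ʳ (List.tabulate edgeVec) (∈-tabulate⁺ v)

  ∈K⁻ : ∀ {x} → x ∈ K → (∃ λ i → x ≡ edgeVec i) ⊎ (∃ λ v → x ≡ vertexVec v)
  ∈K⁻ p with ∈-++⁻ (List.tabulate edgeVec) p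
  ... | inj₁ q = inj₁ (∈-tabulate⁻ q)
  ... | inj₂ q = inj₂ (∈-tabulate⁻ q)

  ≗ʰ⇒≡ : ∀ {x y : Bits M} → (∀ u b → lookup x (idx (u , b)) ≡ lookup y (idx (u , b))) → x ≡ y
  ≗ʰ⇒≡ {x} {y} p = ≗⇒≡ λ i → subst (λ j → lookup x j ≡ lookup y j) (idx∘unidx i) (p (proj₁ (unidx i)) (proj₂ (unidx i)))

  lookup-E : ∀ v a u b → lookup (E (v , a)) (idx (u , b)) ≡ [ v ≟ u ] ∧ [ a ≟ b ]
  lookup-E v a u b = trans (lookup-e (idx (v , a)) (idx (u , b))) (does-⇔ idx≡⇔ (idx (v , a) ≟ᶠ idx (u , b)) (v ≟ᶠ u ×-dec a ≟ᶠ b))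
    where
    idx≡⇔ : (idx (v , a) ≡ idx (u , b)) ⇔ (v ≡ u × a ≡ b)
    idx≡⇔ = mk⇔ (λ eq → cong proj₁ (idx-injective eq) , cong proj₂ (idx-injective eq)) λ { (refl , refl) → refl }

  lookup-vertexVec : ∀ v u b → lookup (vertexVec v) (idx (u , b)) ≡ [ v ≟ u ]
  lookup-vertexVec v u b =
    trans (lookup∘tabulate _ (idx (u , b))) (trans (cong (lookup (e v)) (vtx-idx (u , b))) (lookup-e v u))

  lookup-pairVec : ∀ v t a u b → lookup (pairVec v t a) (idx (u , b)) ≡ ([ v ≟ u ] ∧ [ a ≟ b ]) xor ([ v ≟ u ] ∧ [ mate t a ≟ b ])
  lookup-pairVec v t a u b = trans (lookup-⊕ (E (v , a)) (E (v , mate t a)) _) (cong₂ _xor_ (lookup-E v a u b) (lookup-E v (mate t a) u b))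

  vertexVec-split : ∀ v t → vertexVec v ≡ pairVec v t zero ⊕ pairVec v t (other t)
  vertexVec-split v t = ≗ʰ⇒≡ λ u b → begin
    lookup (vertexVec v) (idx (u , b))
      ≡⟨ lookup-vertexVec v u b ⟩
    [ v ≟ u ]
      ≡⟨ slots [ v ≟ u ] b ⟩
    (([ v ≟ u ] ∧ [ zero ≟ b ]) xor ([ v ≟ u ] ∧ [ mate t zero ≟ b ])) xor
      (([ v ≟ u ] ∧ [ other t ≟ b ]) xor ([ v ≟ u ] ∧ [ mate t (other t) ≟ b ]))
      ≡⟨ sym (trans (lookup-⊕ (pairVec v t zero) (pairVec v t (other t)) _)
                    (cong₂ _xor_ (lookup-pairVec v t zero u b) (lookup-pairVec v t (other t) u b))) ⟩
    lookup (pairVec v t zero ⊕ pairVec v t (other t)) (idx (u , b)) ∎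
    where
    open ≡-Reasoning
    slots : ∀ c b → c ≡ ((c ∧ [ zero ≟ b ]) xor (c ∧ [ mate t zero ≟ b ])) xor
                           ((c ∧ [ other t ≟ b ]) xor (c ∧ [ mate t (other t) ≟ b ]))
    slots false b = refl
    slots true b = sym (pairs-cover t b)

  pairVec-first : ∀ v t a → pairVec v t a ≡ pairVec v t zero ⊕ scale (inOtherPair t a) (vertexVec v)
  pairVec-first v t a = ≗ʰ⇒≡ λ u b → begin
    lookup (pairVec v t a) (idx (u , b))
      ≡⟨ lookup-pairVec v t a u b ⟩
    ([ v ≟ u ] ∧ [ a ≟ b ]) xor ([ v ≟ u ] ∧ [ mate t a ≟ b ])
      ≡⟨ slots [ v ≟ u ] b ⟩
    (([ v ≟ u ] ∧ [ zero ≟ b ]) xor ([ v ≟ u ] ∧ [ mate t zero ≟ b ])) xor (inOtherPair t a ∧ [ v ≟ u ])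
      ≡⟨ sym (trans (lookup-⊕ (pairVec v t zero) (scale (inOtherPair t a) (vertexVec v)) _)
                    (cong₂ _xor_ (lookup-pairVec v t zero u b)
                                 (trans (lookup-scale (inOtherPair t a) (vertexVec v) _)
                                        (cong (inOtherPair t a ∧_) (lookup-vertexVec v u b))))) ⟩
    lookup (pairVec v t zero ⊕ scale (inOtherPair t a) (vertexVec v)) (idx (u , b)) ∎
    where
    open ≡-Reasoning
    slots : ∀ c b → (c ∧ [ a ≟ b ]) xor (c ∧ [ mate t a ≟ b ]) ≡
                    ((c ∧ [ zero ≟ b ]) xor (c ∧ [ mate t zero ≟ b ])) xor (inOtherPair t a ∧ c)
    slots false b = sym (∧-zeroʳ (inOtherPair t a))
    slots true b = trans (pair-vs-first t a b) (cong (([ zero ≟ b ] xor [ mate t zero ≟ b ]) xor_) (sym (∧-identityʳ (inOtherPair t a))))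

  module ContainingK (L : List (Bits M)) (K⊆L : ∀ {x} → x ∈ K → x ∈ L) where

    linked-edge : ∀ h → Linked L (idx h) (idx (σ F h))
    linked-edge h = subst (λ z → Linked L (idx h) z) (σᶠ-idx h) (span-∈ L (K⊆L (edgeVec∈K (idx h))))

    linked-pair : ∀ v t → transitionVec (combine v t) ∈ L → ∀ a → Linked L (idx (v , a)) (idx (v , mate t a))
    linked-pair v t t∈L a = subst (Span L) (sym (pairVec-first v t a))
      (span-⊕ L (subst (Span L) (transitionVec-combine v t) (span-∈ L t∈L))
                (span-scale L (inOtherPair t a) (span-∈ L (K⊆L (vertexVec∈K v)))))

    linked-vertex : ∀ v → (∀ t → transitionVec (combine v t) ∈ L) → ∀ a b → Linked L (idx (v , a)) (idx (v , b))
    linked-vertex v all∈L a b with a ≟ᶠ b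
    ... | yes refl = linked-refl L _
    ... | no a≢b with mate-surjective a b a≢b
    ... | t , refl = linked-pair v t (all∈L t) a

  module Collapse {k : ℕ} (f : Fin M → Fin k) (rep : Fin k → Fin M) (f∘rep : ∀ j → f (rep j) ≡ j) where

    open Partition f rep f∘rep public

    ConstantOnPairs : Fin n → Fin 3 → Set
    ConstantOnPairs v t = ∀ a → f (idx (v , a)) ≡ f (idx (v , mate t a))

    collapse-pairVec : ∀ {v t} → ConstantOnPairs v t → collapse (pairVec v t zero) ≡ 𝟘
    collapse-pairVec same = collapse-link (same zero)

    collapse-vertexVec : ∀ {v t} → ConstantOnPairs v t → collapse (vertexVec v) ≡ 𝟘
    collapse-vertexVec {v} {t} same = begin
      collapse (vertexVec v)                                        ≡⟨ cong collapse (vertexVec-split v t) ⟩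
      collapse (pairVec v t zero ⊕ pairVec v t (other t))          ≡⟨ additive collapse-linear (pairVec v t zero) (pairVec v t (other t)) ⟩
      collapse (pairVec v t zero) ⊕ collapse (pairVec v t (other t)) ≡⟨ cong₂ _⊕_ (collapse-link (same zero)) (collapse-link (same (other t))) ⟩
      𝟘 ⊕ 𝟘                                                         ≡⟨ ⊕-self 𝟘 ⟩
      𝟘                                                             ∎
      where open ≡-Reasoning

    collapse-edgeVec : ∀ {i} → f i ≡ f (σᶠ i) → collapse (edgeVec i) ≡ 𝟘
    collapse-edgeVec = collapse-link

  adjacent-σ : ∀ i → Adj F (vtx i) (vtx (σᶠ i))
  adjacent-σ i = proj₂ (unidx i) , proj₂ (σ F (unidx i)) , sym (cong (_, proj₂ (σ F (unidx i))) (vtx-idx (σ F (unidx i))))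

  swap : Bits M → Bits M
  swap w = tabulate (λ i → lookup w (σᶠ i))

  lookup-swap : ∀ w i → lookup (swap w) i ≡ lookup w (σᶠ i)
  lookup-swap w i = lookup∘tabulate _ i

  swap-linear : IsLinear swap
  swap-linear = record { additive = λ x y → ≗⇒≡ λ i → begin
    lookup (swap (x ⊕ y)) i                ≡⟨ lookup-swap (x ⊕ y) i ⟩
    lookup (x ⊕ y) (σᶠ i)                  ≡⟨ lookup-⊕ x y (σᶠ i) ⟩
    lookup x (σᶠ i) xor lookup y (σᶠ i)    ≡⟨ sym (cong₂ _xor_ (lookup-swap x i) (lookup-swap y i)) ⟩
    lookup (swap x) i xor lookup (swap y) i ≡⟨ sym (lookup-⊕ (swap x) (swap y) i) ⟩
    lookup (swap x ⊕ swap y) i             ∎ }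
    where open ≡-Reasoning

  swap-involutive : ∀ w → swap (swap w) ≡ w
  swap-involutive w = ≗⇒≡ λ i →
    trans (lookup-swap (swap w) i) (trans (lookup-swap w (σᶠ i)) (cong (lookup w) (σᶠ-involutive i)))

  swap-e : ∀ i → swap (e i) ≡ e (σᶠ i)
  swap-e i = ≗⇒≡ λ j → begin
    lookup (swap (e i)) j  ≡⟨ lookup-swap (e i) j ⟩
    lookup (e i) (σᶠ j)    ≡⟨ lookup-e i (σᶠ j) ⟩
    does (i ≟ᶠ σᶠ j)       ≡⟨ does-⇔ (mk⇔ (λ eq → trans (cong σᶠ eq) (σᶠ-involutive j))
                                          (λ eq → trans (sym (σᶠ-involutive i)) (cong σᶠ eq)))
                                     (i ≟ᶠ σᶠ j) (σᶠ i ≟ᶠ j) ⟩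
    does (σᶠ i ≟ᶠ j)       ≡⟨ sym (lookup-e (σᶠ i) j) ⟩
    lookup (e (σᶠ i)) j    ∎
    where open ≡-Reasoning

  twist : Bits M → Bits M
  twist w = w ⊕ swap w

  twist-linear : IsLinear twist
  twist-linear = record { additive = λ x y →
    trans (cong ((x ⊕ y) ⊕_) (additive swap-linear x y)) (⊕-interchange x y (swap x) (swap y)) }

  twist∘twist : ∀ w → twist (twist w) ≡ 𝟘
  twist∘twist w = begin
    twist w ⊕ swap (w ⊕ swap w)         ≡⟨ cong (twist w ⊕_) (additive swap-linear w (swap w)) ⟩
    twist w ⊕ (swap w ⊕ swap (swap w))  ≡⟨ cong (λ z → twist w ⊕ (swap w ⊕ z)) (swap-involutive w) ⟩
    twist w ⊕ (swap w ⊕ w)              ≡⟨ cong (twist w ⊕_) (⊕-comm (swap w) w) ⟩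
    twist w ⊕ twist w                   ≡⟨ ⊕-self (twist w) ⟩
    𝟘                                   ∎
    where open ≡-Reasoning

  twist-e : ∀ i → twist (e i) ≡ edgeVec i
  twist-e i = cong (e i ⊕_) (swap-e i)

  ker-twist-symmetric : ∀ {y} → twist y ≡ 𝟘 → ∀ i → lookup y (σᶠ i) ≡ lookup y i
  ker-twist-symmetric {y} eq i = sym (xor≡false⇒≡ (begin
    lookup y i xor lookup y (σᶠ i)      ≡⟨ cong (lookup y i xor_) (sym (lookup-swap y i)) ⟩
    lookup y i xor lookup (swap y) i    ≡⟨ sym (lookup-⊕ y (swap y) i) ⟩
    lookup (twist y) i                  ≡⟨ cong (λ z → lookup z i) eq ⟩
    lookup 𝟘 i                          ≡⟨ lookup-𝟘 i ⟩
    false                               ∎))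
    where
    open ≡-Reasoning

  <-xor-> : ∀ {k} {i j : Fin k} → i ≢ j → does (i <?ᶠ j) xor does (j <?ᶠ i) ≡ true
  <-xor-> {i = i} {j} i≢j with <-cmpᶠ i j
  ... | tri< i<j _ j≮i = cong₂ _xor_ (dec-true (i <?ᶠ j) i<j) (dec-false (j <?ᶠ i) j≮i)
  ... | tri≈ _ i≡j _ = ⊥-elim (i≢j i≡j)
  ... | tri> i≮j _ j<i = cong₂ _xor_ (dec-false (i <?ᶠ j) i≮j) (dec-true (j <?ᶠ i) j<i)

  -- keep one half-edge of each edge
  half : Bits M → Bits M
  half y = tabulate (λ i → lookup y i ∧ does (i <?ᶠ σᶠ i))

  twist∘half : ∀ {y} → twist y ≡ 𝟘 → twist (half y) ≡ y
  twist∘half {y} eq = ≗⇒≡ λ i → begin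
    lookup (half y ⊕ swap (half y)) i
      ≡⟨ lookup-⊕ (half y) (swap (half y)) i ⟩
    lookup (half y) i xor lookup (swap (half y)) i
      ≡⟨ cong₂ _xor_ (lookup∘tabulate _ i) (trans (lookup-swap (half y) i) (lookup∘tabulate _ (σᶠ i))) ⟩
    (lookup y i ∧ does (i <?ᶠ σᶠ i)) xor (lookup y (σᶠ i) ∧ does (σᶠ i <?ᶠ σᶠ (σᶠ i)))
      ≡⟨ cong₂ (λ a j → (lookup y i ∧ does (i <?ᶠ σᶠ i)) xor (a ∧ does (σᶠ i <?ᶠ j)))
               (ker-twist-symmetric eq i) (σᶠ-involutive i) ⟩
    (lookup y i ∧ does (i <?ᶠ σᶠ i)) xor (lookup y i ∧ does (σᶠ i <?ᶠ i))
      ≡⟨ sym (∧-distribˡ-xor (lookup y i) _ _) ⟩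
    lookup y i ∧ (does (i <?ᶠ σᶠ i) xor does (σᶠ i <?ᶠ i))
      ≡⟨ cong (lookup y i ∧_) (<-xor-> (σᶠ-irreflexive i ∘ sym)) ⟩
    lookup y i ∧ true
      ≡⟨ ∧-identityʳ (lookup y i) ⟩
    lookup y i ∎
    where open ≡-Reasoning

  lookup-lift : ∀ b i → lookup (lift b) i ≡ lookup b (vtx i)
  lookup-lift b i = lookup∘tabulate _ i

  lift-linear : IsLinear lift
  lift-linear = record { additive = λ x y → ≗⇒≡ λ i →
    trans (lookup-lift (x ⊕ y) i) (trans (lookup-⊕ x y (vtx i))
      (sym (trans (lookup-⊕ (lift x) (lift y) i) (cong₂ _xor_ (lookup-lift x i) (lookup-lift y i))))) }

  coboundary : Bits n → Bits M
  coboundary b = twist (lift b)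

  coboundary-linear : IsLinear coboundary
  coboundary-linear = record { additive = λ x y →
    trans (cong twist (additive lift-linear x y)) (additive twist-linear (lift x) (lift y)) }

  lookup-coboundary : ∀ b i → lookup (coboundary b) i ≡ lookup b (vtx i) xor lookup b (vtx (σᶠ i))
  lookup-coboundary b i = trans (lookup-⊕ (lift b) (swap (lift b)) i)
    (cong₂ _xor_ (lookup-lift b i) (trans (lookup-swap (lift b) i) (lookup-lift b (σᶠ i))))

  span-K⇒ : ∀ {w} → Span K w → Im coboundary (twist w)
  span-K⇒ = span-ind K (λ w → Im coboundary (twist w))
    (𝟘 , trans (φ-𝟘 coboundary-linear) (sym (φ-𝟘 twist-linear)))
    (λ { {x} {y} (b , eb) (b′ , eb′) →
         b ⊕ b′ , trans (additive coboundary-linear b b′) (trans (cong₂ _⊕_ eb eb′) (sym (additive twist-linear x y))) })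
    generator
    where
    generator : ∀ {v} → v ∈ K → Im coboundary (twist v)
    generator p with ∈K⁻ p
    ... | inj₁ (i , refl) = 𝟘 , trans (φ-𝟘 coboundary-linear) (sym (trans (cong twist (sym (twist-e i))) (twist∘twist (e i))))
    ... | inj₂ (v , refl) = e v , refl

  -- w ⊕ lift b lies in Ker twist = Im twist, which is spanned by the edge vectors.
  span-K⇐ : ∀ {w} → Im coboundary (twist w) → Span K w
  span-K⇐ {w} (b , eq) = subst (Span K) (⊕-cancelʳ w (lift b)) (span-⊕ K span-u span-lift)
    where
    u = w ⊕ lift b
    twist-u : twist u ≡ 𝟘
    twist-u = trans (additive twist-linear w (lift b)) (trans (cong (twist w ⊕_) eq) (⊕-self (twist w)))
    span-u : Span K u
    span-u = subst (Span K) (twist∘half twist-u)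
      (span-linear K twist-linear (λ i → subst (Span K) (sym (twist-e i)) (span-∈ K (edgeVec∈K i))) (half u))
    span-lift : Span K (lift b)
    span-lift = span-linear K lift-linear (λ v → span-∈ K (vertexVec∈K v)) b

  count-ker-twist² : count (Ker? twist) * count (Ker? twist) ≡ 2 ^ M
  count-ker-twist² = trans (cong (count (Ker? twist) *_) ker≡im) (sym (rank-nullity twist-linear))
    where
    ker≡im : count (Ker? twist) ≡ count (Im? twist)
    ker≡im = count-cong (Ker? twist) (Im? twist) (λ {y} eq → half y , twist∘half eq) (λ { (x , refl) → twist∘twist x })

  count-span-K : count (span? K) ≡ count (Ker? twist) * count (Im? coboundary)
  count-span-K = begin
    count (span? K)
      ≡⟨ count-cong (span? K) (Im? coboundary ∘ twist) span-K⇒ span-K⇐ ⟩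
    count (Im? coboundary ∘ twist)
      ≡⟨ count-preimage twist-linear (Im? coboundary) ⟩
    count (Ker? twist) * count (λ y → Im? coboundary y ×-dec Im? twist y)
      ≡⟨ cong (count (Ker? twist) *_) (count-cong _ (Im? coboundary) proj₁
                (λ { {y} (b , refl) → (b , refl) , lift b , refl })) ⟩
    count (Ker? twist) * count (Im? coboundary) ∎
    where open ≡-Reasoning

  module CircuitClasses (P : CircuitPartition F) where

    Pos : Fin (size P) → Set
    Pos j = Fin (suc (len (circ P j))) ⊎ Fin (suc (len (circ P j)))

    hp : ∀ j → Fin (suc (len (circ P j))) → H
    hp j = he (circ P j)

    at : ∀ j → Pos j → H
    at j = halves F (hp j)

    at-injective : ∀ {j j′} (s : Pos j) (s′ : Pos j′) → at j s ≡ at j′ s′ → Σ (j ≡ j′) λ { refl → s ≡ s′ }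
    at-injective {j} {j′} s s′ eq with disjoint P j j′ s s′ eq
    ... | refl = refl , distinct (circ P j) s s′ eq

    classOf : H → Fin (size P)
    classOf x = proj₁ (cover P x)

    classOf-at : ∀ j (s : Pos j) → classOf (at j s) ≡ j
    classOf-at j s = let (_ , s′ , eq) = cover P (at j s) in disjoint P _ j s′ s eq

    classOf-σ : ∀ x → classOf (σ F x) ≡ classOf x
    classOf-σ x with cover P x
    ... | j , inj₁ i , refl = classOf-at j (inj₂ i)
    ... | j , inj₂ i , refl = trans (cong classOf (σ-invol F (hp j i))) (classOf-at j (inj₁ i))

    Passage : Set
    Passage = Σ (Fin (size P)) λ j → Fin (suc (len (circ P j)))

    entry exit : Passage → H
    entry (j , i) = hp j i
    exit (j , i) = σ F (hp j (prev i))

    exit-vertex : ∀ p → vertex (exit p) ≡ vertex (entry p)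
    exit-vertex (j , i) = passage (circ P j) i

    _∈ᵖ_ : H → Passage → Set
    x ∈ᵖ p = x ≡ entry p ⊎ x ≡ exit p

    classOf-∈ᵖ : ∀ {x p} → x ∈ᵖ p → classOf x ≡ proj₁ p
    classOf-∈ᵖ {p = j , i} (inj₁ refl) = classOf-at j (inj₁ i)
    classOf-∈ᵖ {p = j , i} (inj₂ refl) = classOf-at j (inj₂ (prev i))

    prev-surjective : ∀ {k} (i : Fin (suc k)) → ∃ λ i′ → prev i′ ≡ i
    prev-surjective {k} i with k ≟ⁿ toℕ i
    ... | yes k≡i = zero , toℕ-injective (trans (toℕ-fromℕ k) k≡i)
    ... | no k≢i = suc (lower₁ i k≢i) , inject₁-lower₁ i k≢i

    prev-injective : ∀ {k} {i i′ : Fin (suc k)} → prev i ≡ prev i′ → i ≡ i′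
    prev-injective {i = zero} {zero} eq = refl
    prev-injective {i = zero} {suc i′} eq = ⊥-elim (fromℕ≢inject₁ eq)
    prev-injective {i = suc i} {zero} eq = ⊥-elim (fromℕ≢inject₁ (sym eq))
    prev-injective {i = suc i} {suc i′} eq = cong suc (inject₁-injective eq)

    passageOf : ∀ x → ∃ λ p → x ∈ᵖ p
    passageOf x with cover P x
    ... | j , inj₁ i , refl = (j , i) , inj₁ refl
    ... | j , inj₂ i , refl with prev-surjective i
    ... | i′ , refl = (j , i′) , inj₂ refl

    entry≢exit : ∀ p q → entry p ≢ exit q
    entry≢exit (j , i) (j′ , i′) eq with at-injective (inj₁ i) (inj₂ (prev i′)) eq
    ... | refl , ()

    passage-unique : ∀ {x p q} → x ∈ᵖ p → x ∈ᵖ q → p ≡ q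
    passage-unique {p = j , i} {j′ , i′} (inj₁ refl) (inj₁ eq) with at-injective (inj₁ i) (inj₁ i′) eq
    ... | refl , refl = refl
    passage-unique {p = j , i} {j′ , i′} (inj₂ refl) (inj₂ eq) with at-injective (inj₂ (prev i)) (inj₂ (prev i′)) eq
    ... | refl , refl′ = cong (j ,_) (prev-injective (inj₂-injective refl′))
    passage-unique {p = p} {q} (inj₁ refl) (inj₂ eq) = ⊥-elim (entry≢exit p q eq)
    passage-unique {p = p} {q} (inj₂ refl) (inj₁ eq) = ⊥-elim (entry≢exit q p (sym eq))

    partner : ∀ {x p} → x ∈ᵖ p → H
    partner {p = p} (inj₁ _) = exit p
    partner {p = p} (inj₂ _) = entry p

    partner-∈ᵖ : ∀ {x p} (x∈p : x ∈ᵖ p) → partner x∈p ∈ᵖ p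
    partner-∈ᵖ (inj₁ _) = inj₂ refl
    partner-∈ᵖ (inj₂ _) = inj₁ refl

    partner-vertex : ∀ {x p} (x∈p : x ∈ᵖ p) → vertex (partner x∈p) ≡ vertex x
    partner-vertex {p = p} (inj₁ refl) = exit-vertex p
    partner-vertex {p = p} (inj₂ refl) = sym (exit-vertex p)

    partner-≢ : ∀ {x p} (x∈p : x ∈ᵖ p) → partner x∈p ≢ x
    partner-≢ {p = p} (inj₁ refl) eq = entry≢exit p p (sym eq)
    partner-≢ {p = p} (inj₂ refl) eq = entry≢exit p p eq

    passage-transition : ∀ p → ∃ λ t → mate t (slot (exit p)) ≡ slot (entry p)
    passage-transition p = mate-surjective _ _ λ eq → entry≢exit p p (sym (×-≡,≡→≡ (exit-vertex p , eq)))

    entry-vertex : ∀ {x p} → x ∈ᵖ p → vertex (entry p) ≡ vertex x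
    entry-vertex (inj₁ refl) = refl
    entry-vertex {p = p} (inj₂ refl) = sym (exit-vertex p)

    usedAt : ∀ v → ∃ λ t → Uses P v t
    usedAt v with passageOf (v , zero)
    ... | (j , i) , v0∈p with passage-transition (j , i)
    ... | t , mt = t , j , i , entry-vertex v0∈p , mt

    ∈ᵖ-partner : ∀ {x p q} (x∈q : x ∈ᵖ q) → partner x∈q ∈ᵖ p → x ∈ᵖ p
    ∈ᵖ-partner x∈q y∈p with passage-unique (partner-∈ᵖ x∈q) y∈p
    ... | refl = x∈q

    -- Either (v , a) and (v , mate t a) form the passage p using t, or the passage through
    -- (v , a) is disjoint from p and so uses the two remaining slots.
    module _ {p : Passage} {t : Fin 3} (mt : mate t (slot (exit p)) ≡ slot (entry p)) where

      private
        v = vertex (entry p)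
        a₁ = slot (exit p)
        a₂ = slot (entry p)

        exit≡ : exit p ≡ (v , a₁)
        exit≡ = ×-≡,≡→≡ (exit-vertex p , refl)

        class₁ : classOf (v , a₁) ≡ proj₁ p
        class₁ = trans (cong classOf (sym exit≡)) (classOf-∈ᵖ {p = p} (inj₂ refl))

        class₂ : classOf (v , a₂) ≡ proj₁ p
        class₂ = classOf-∈ᵖ {p = p} (inj₁ refl)

        slot-∈ᵖ : ∀ {b} → (v , b) ∈ᵖ p → b ≡ a₂ ⊎ b ≡ a₁
        slot-∈ᵖ (inj₁ eq) = inj₁ (cong proj₂ eq)
        slot-∈ᵖ (inj₂ eq) = inj₂ (cong proj₂ (trans eq exit≡))

        remaining : ∀ {a} → a ≢ a₁ → a ≢ a₂ → classOf (v , a) ≡ classOf (v , mate t a)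
        remaining {a} a≢a₁ a≢a₂ with passageOf (v , a)
        ... | q , a∈q = trans (classOf-∈ᵖ a∈q) (sym (trans (cong classOf (sym y≡)) (classOf-∈ᵖ (partner-∈ᵖ a∈q))))
          where
          y = partner a∈q
          y≡ : y ≡ (v , mate t a)
          y≡ = ×-≡,≡→≡ (partner-vertex a∈q , mate-remaining t a₁ a (slot y) a≢a₁ (a≢a₂ ∘ flip trans mt) y≢a₁ (y≢a₂ ∘ flip trans mt) y≢a)
            where
            y-at-v : ∀ {b} → slot y ≡ b → y ≡ (v , b)
            y-at-v eq = ×-≡,≡→≡ (partner-vertex a∈q , eq)
            not-in-p : ∀ {b} → y ≡ (v , b) → (v , b) ∈ᵖ p → ⊥
            not-in-p y≡vb vb∈p = [ a≢a₂ , a≢a₁ ]′ (slot-∈ᵖ (∈ᵖ-partner a∈q (subst (_∈ᵖ p) (sym y≡vb) vb∈p)))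
            y≢a₁ : slot y ≢ a₁
            y≢a₁ eq = not-in-p (y-at-v eq) (inj₂ (sym exit≡))
            y≢a₂ : slot y ≢ a₂
            y≢a₂ eq = not-in-p (y-at-v eq) (inj₁ refl)
            y≢a : slot y ≢ a
            y≢a eq = partner-≢ a∈q (y-at-v eq)

      passage-class : ∀ a → classOf (v , a) ≡ classOf (v , mate t a)
      passage-class a with a ≟ᶠ a₁ | a ≟ᶠ a₂
      ... | yes refl | _ = trans class₁ (sym (trans (cong (λ b → classOf (v , b)) mt) class₂))
      ... | no _ | yes refl = trans class₂ (sym (trans (cong (λ b → classOf (v , b)) (trans (cong (mate t) (sym mt)) (mate-involutive t a₁))) class₁))
      ... | no a≢a₁ | no a≢a₂ = remaining a≢a₁ a≢a₂

    transition-class : ∀ {v t} → Uses P v t → ∀ a → classOf (v , a) ≡ classOf (v , mate t a)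
    transition-class (j , i , refl , mt) = passage-class {p = j , i} mt

    module _ (S : Subset (n * 3)) (τP≡S : IsTau P S) where

      classᶠ : Fin M → Fin (size P)
      classᶠ i = classOf (unidx i)

      classᶠ-idx : ∀ h → classᶠ (idx h) ≡ classOf h
      classᶠ-idx h = cong classOf (unidx∘idx h)

      start : Fin (size P) → Fin M
      start j = idx (hp j zero)

      open Collapse classᶠ start (λ j → trans (classᶠ-idx (hp j zero)) (classOf-at j (inj₁ zero)))

      used∈family : ∀ {v t} → Uses P v t → transitionVec (combine v t) ∈ family S
      used∈family {v} {t} u = ∈-++⁺ˡ (∈-select⁺ transitionVec S (Equivalence.from (τP≡S v t) u))

      used-constantOnPairs : ∀ {v t} → Uses P v t → ConstantOnPairs v t
      used-constantOnPairs u a = trans (classᶠ-idx _) (trans (transition-class u a) (sym (classᶠ-idx _)))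

      family⊆ker : ∀ {x} → x ∈ family S → collapse x ≡ 𝟘
      family⊆ker p with ∈-++⁻ (select transitionVec S) p
      ... | inj₁ q with ∈-select⁻ transitionVec S q
      ... | g , g∈S , refl = collapse-pairVec (used-constantOnPairs (Equivalence.to (τP≡S v t) vt∈S))
        where
        v = proj₁ (remQuot {n} 3 g)
        t = proj₂ (remQuot {n} 3 g)
        vt∈S : combine v t ∈ˢ S
        vt∈S = subst (_∈ˢ S) (sym (combine-remQuot {n} 3 g)) g∈S
      family⊆ker p | inj₂ q with ∈K⁻ q
      ... | inj₁ (i , refl) = collapse-edgeVec (trans (sym (classOf-σ (unidx i))) (sym (classᶠ-idx (σ F (unidx i)))))
      ... | inj₂ (v , refl) = collapse-vertexVec (used-constantOnPairs (proj₂ (usedAt v)))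

      open ContainingK (family S) (∈-++⁺ʳ (select transitionVec S))

      linked-passage : ∀ p → Linked (family S) (idx (exit p)) (idx (entry p))
      linked-passage p with passage-transition p
      ... | t , mt = subst₂ (λ a b → Linked (family S) (idx a) (idx b))
                       (sym (×-≡,≡→≡ (exit-vertex p , refl))) (cong (vertex (entry p) ,_) mt)
                       (linked-pair (vertex (entry p)) t (used∈family (proj₁ p , proj₂ p , refl , mt)) _)

      linked-start : ∀ j i → Linked (family S) (idx (hp j i)) (start j)
      linked-start j = <-weakInduction (λ i → Linked (family S) (idx (hp j i)) (start j)) (linked-refl _ _)
        λ i ih → linked-trans _ (linked-sym _ (linked-passage (j , suc i)))
                   (linked-trans _ (linked-sym _ (linked-edge (hp j (inject₁ i)))) ih)

      linked-class : ∀ x → Linked (family S) x (start (classᶠ x))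
      linked-class x with cover P (unidx x)
      ... | j , inj₁ i , eq = subst (λ z → Linked (family S) z (start j)) (trans (cong idx eq) (idx∘unidx x)) (linked-start j i)
      ... | j , inj₂ i , eq = subst (λ z → Linked (family S) z (start j)) (trans (cong idx eq) (idx∘unidx x))
                                (linked-trans _ (linked-sym _ (linked-edge (hp j i))) (linked-start j i))

      rk-family : rk (family S) + size P ≡ M
      rk-family = rk-partition (family S) family⊆ker λ {x} {y} eq →
        linked-trans _ (linked-class x) (subst (λ z → Linked (family S) (start z) y) (sym eq) (linked-sym _ (linked-class y)))

  edges : List (Fin n × Fin n)
  edges = List.tabulate (λ i → vtx i , vtx (σᶠ i))

  edgeIn⇒adj : ∀ {u w} → EdgeIn edges u w → Adj F u w
  edgeIn⇒adj p with Any.tabulate⁻ p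
  ... | i , inj₁ (refl , refl) = adjacent-σ i
  ... | i , inj₂ (refl , refl) = subst (Adj F (vtx (σᶠ i)) ∘ vtx) (σᶠ-involutive i) (adjacent-σ (σᶠ i))

  adj⇒edgeIn : ∀ {u w} → Adj F u w → EdgeIn edges u w
  adj⇒edgeIn {u} {w} (a , b , σua≡) = Any.tabulate⁺ (idx (u , a))
    (inj₁ (sym (vtx-idx (u , a)) , sym (trans (cong vtx (σᶠ-idx (u , a))) (trans (vtx-idx (σ F (u , a))) (cong proj₁ σua≡)))))

  hasComponents : ∃ λ c → HasComponents F c
  hasComponents with components edges
  ... | c , f , f-onto , f⇔ = c , f , f-onto , λ u w →
    mk⇔ (star-map edgeIn⇒adj ∘ Equivalence.to (f⇔ u w)) (Equivalence.from (f⇔ u w) ∘ star-map adj⇒edgeIn)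

  module Components (c : ℕ) (hc : HasComponents F c) where

    comp : Fin n → Fin c
    comp = proj₁ hc

    compRep : Fin c → Fin n
    compRep j = proj₁ (proj₁ (proj₂ hc) j)

    comp∘compRep : ∀ j → comp (compRep j) ≡ j
    comp∘compRep j = proj₂ (proj₁ (proj₂ hc) j)

    comp⇒connected : ∀ {u w} → comp u ≡ comp w → Connected F u w
    comp⇒connected {u} {w} = Equivalence.to (proj₂ (proj₂ hc) u w)

    connected⇒comp : ∀ {u w} → Connected F u w → comp u ≡ comp w
    connected⇒comp {u} {w} = Equivalence.from (proj₂ (proj₂ hc) u w)

    pullback : Bits c → Bits n
    pullback g = tabulate (λ u → lookup g (comp u))

    lookup-pullback : ∀ g u → lookup (pullback g) u ≡ lookup g (comp u)
    lookup-pullback g u = lookup∘tabulate _ u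

    pullback-linear : IsLinear pullback
    pullback-linear = record { additive = λ x y → ≗⇒≡ λ u →
      trans (lookup-pullback (x ⊕ y) u) (trans (lookup-⊕ x y (comp u))
        (sym (trans (lookup-⊕ (pullback x) (pullback y) u) (cong₂ _xor_ (lookup-pullback x u) (lookup-pullback y u))))) }

    pullback-injective : ∀ {g} → pullback g ≡ 𝟘 → g ≡ 𝟘
    pullback-injective {g} eq = ≗⇒≡ λ j → begin
      lookup g j                      ≡⟨ cong (lookup g) (sym (comp∘compRep j)) ⟩
      lookup g (comp (compRep j))     ≡⟨ sym (lookup-pullback g (compRep j)) ⟩
      lookup (pullback g) (compRep j) ≡⟨ cong (λ z → lookup z (compRep j)) eq ⟩
      lookup 𝟘 (compRep j)            ≡⟨ lookup-𝟘 (compRep j) ⟩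
      false                           ≡⟨ sym (lookup-𝟘 j) ⟩
      lookup 𝟘 j                      ∎
      where open ≡-Reasoning

    ker-coboundary-edge : ∀ b → coboundary b ≡ 𝟘 → ∀ h → lookup b (vertex h) ≡ lookup b (vertex (σ F h))
    ker-coboundary-edge b eq h = begin
      lookup b (vertex h)                                 ≡⟨ cong (lookup b) (sym (vtx-idx h)) ⟩
      lookup b (vtx (idx h))                              ≡⟨ xor≡false⇒≡ (begin
        lookup b (vtx (idx h)) xor lookup b (vtx (σᶠ (idx h))) ≡⟨ sym (lookup-coboundary b (idx h)) ⟩
        lookup (coboundary b) (idx h)                          ≡⟨ cong (λ z → lookup z (idx h)) eq ⟩
        lookup 𝟘 (idx h)                                       ≡⟨ lookup-𝟘 (idx h) ⟩
        false                                                  ∎) ⟩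
      lookup b (vtx (σᶠ (idx h)))                         ≡⟨ cong (lookup b) (trans (cong vtx (σᶠ-idx h)) (vtx-idx (σ F h))) ⟩
      lookup b (vertex (σ F h))                           ∎
      where open ≡-Reasoning

    ker-coboundary-constant : ∀ b → coboundary b ≡ 𝟘 → ∀ {u w} → Connected F u w → lookup b u ≡ lookup b w
    ker-coboundary-constant b eq ε = refl
    ker-coboundary-constant b eq {u} ((a , _ , σua≡) ◅ rest) =
      trans (trans (ker-coboundary-edge b eq (u , a)) (cong (lookup b ∘ vertex) σua≡)) (ker-coboundary-constant b eq rest)

    ker-coboundary⇒im-pullback : ∀ {b} → coboundary b ≡ 𝟘 → Im pullback b
    ker-coboundary⇒im-pullback {b} eq = tabulate (λ j → lookup b (compRep j)) , ≗⇒≡ λ u → begin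
      lookup (pullback (tabulate (λ j → lookup b (compRep j)))) u ≡⟨ lookup-pullback (tabulate (λ j → lookup b (compRep j))) u ⟩
      lookup (tabulate (λ j → lookup b (compRep j))) (comp u)    ≡⟨ lookup∘tabulate _ (comp u) ⟩
      lookup b (compRep (comp u))                                ≡⟨ sym (ker-coboundary-constant b eq (comp⇒connected (sym (comp∘compRep (comp u))))) ⟩
      lookup b u                                                 ∎
      where open ≡-Reasoning

    im-pullback⇒ker-coboundary : ∀ {b} → Im pullback b → coboundary b ≡ 𝟘
    im-pullback⇒ker-coboundary (g , refl) = ≗⇒≡ λ i → begin
      lookup (coboundary (pullback g)) i                       ≡⟨ lookup-coboundary (pullback g) i ⟩
      lookup (pullback g) (vtx i) xor lookup (pullback g) (vtx (σᶠ i))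
        ≡⟨ cong₂ _xor_ (lookup-pullback g (vtx i)) (lookup-pullback g (vtx (σᶠ i))) ⟩
      lookup g (comp (vtx i)) xor lookup g (comp (vtx (σᶠ i))) ≡⟨ cong (λ z → lookup g (comp (vtx i)) xor lookup g z) (sym (connected⇒comp (adjacent-σ i ◅ ε))) ⟩
      lookup g (comp (vtx i)) xor lookup g (comp (vtx i))      ≡⟨ xor-same (lookup g (comp (vtx i))) ⟩
      false                                                    ≡⟨ sym (lookup-𝟘 i) ⟩
      lookup 𝟘 i                                               ∎
      where open ≡-Reasoning

    count-ker-coboundary : count (Ker? coboundary) ≡ 2 ^ c
    count-ker-coboundary = begin
      count (Ker? coboundary)                        ≡⟨ count-cong (Ker? coboundary) (Im? pullback) ker-coboundary⇒im-pullback im-pullback⇒ker-coboundary ⟩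
      count (Im? pullback)                           ≡⟨ sym (*-identityˡ _) ⟩
      1 * count (Im? pullback)                       ≡⟨ cong (_* count (Im? pullback)) (sym count-ker-pullback) ⟩
      count (Ker? pullback) * count (Im? pullback)   ≡⟨ sym (rank-nullity pullback-linear) ⟩
      2 ^ c                                          ∎
      where
      open ≡-Reasoning
      count-ker-pullback : count (Ker? pullback) ≡ 1
      count-ker-pullback = trans (count-cong (Ker? pullback) (_≟ᵛ 𝟘) pullback-injective (λ { refl → φ-𝟘 pullback-linear })) (count-𝟘 {c})

    -- |Ker twist|² = 2 ^ (n * 4) shows that 2 ^ (rk K + c) and 2 ^ (n * 3) have the same square.
    rk-K : rk K + c ≡ n * 3
    rk-K = 2^-injective (m*m≡n*n⇒m≡n (begin
      2 ^ (rk K + c) * 2 ^ (rk K + c)              ≡⟨ cong₂ _*_ 2^[rk-K+c] 2^[rk-K+c] ⟩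
      (κ * 2 ^ n) * (κ * 2 ^ n)                    ≡⟨ interchange *-commutativeSemigroup κ (2 ^ n) κ (2 ^ n) ⟩
      (κ * κ) * (2 ^ n * 2 ^ n)                    ≡⟨ cong₂ _*_ count-ker-twist² (sym (^-distribˡ-+-* 2 n n)) ⟩
      2 ^ (n * 4) * 2 ^ (n + n)                    ≡⟨ sym (^-distribˡ-+-* 2 (n * 4) (n + n)) ⟩
      2 ^ (n * 4 + (n + n))                        ≡⟨ cong (2 ^_) (exponents n) ⟩
      2 ^ (n * 3 + n * 3)                          ≡⟨ ^-distribˡ-+-* 2 (n * 3) (n * 3) ⟩
      2 ^ (n * 3) * 2 ^ (n * 3)                    ∎))
      where
      open ≡-Reasoning
      κ = count (Ker? twist)
      exponents : ∀ n → n * 4 + (n + n) ≡ n * 3 + n * 3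
      exponents = solve-∀
      2^[rk-K+c] : 2 ^ (rk K + c) ≡ κ * 2 ^ n
      2^[rk-K+c] = begin
        2 ^ (rk K + c)                                   ≡⟨ ^-distribˡ-+-* 2 (rk K) c ⟩
        2 ^ rk K * 2 ^ c                                 ≡⟨ cong₂ _*_ (trans (sym (count-span K)) count-span-K) (sym count-ker-coboundary) ⟩
        (κ * count (Im? coboundary)) * count (Ker? coboundary) ≡⟨ *-assoc κ _ _ ⟩
        κ * (count (Im? coboundary) * count (Ker? coboundary)) ≡⟨ cong (κ *_) (*-comm (count (Im? coboundary)) _) ⟩
        κ * (count (Ker? coboundary) * count (Im? coboundary)) ≡⟨ cong (κ *_) (sym (rank-nullity coboundary-linear)) ⟩
        κ * 2 ^ n                                        ∎

    rank-formula : ∀ X k → rk (family X) + k ≡ M → rank X + k ≡ n + c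
    rank-formula X k rk+k≡M = +-cancelʳ-≡ (rk K) _ _ (begin
      (rk (family X) ∸ rk K) + k + rk K  ≡⟨ +-assoc (rk (family X) ∸ rk K) k (rk K) ⟩
      (rk (family X) ∸ rk K) + (k + rk K) ≡⟨ cong ((rk (family X) ∸ rk K) +_) (+-comm k (rk K)) ⟩
      (rk (family X) ∸ rk K) + (rk K + k) ≡⟨ sym (+-assoc (rk (family X) ∸ rk K) (rk K) k) ⟩
      (rk (family X) ∸ rk K) + rk K + k  ≡⟨ cong (_+ k) (m∸n+n≡m (rk-K≤ X)) ⟩
      rk (family X) + k                  ≡⟨ rk+k≡M ⟩
      n * 4                              ≡⟨ *-suc n 3 ⟩
      n + n * 3                          ≡⟨ cong (n +_) (trans (sym rk-K) (+-comm (rk K) c)) ⟩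
      n + (c + rk K)                     ≡⟨ sym (+-assoc n c (rk K)) ⟩
      n + c + rk K                       ∎)
      where open ≡-Reasoning

    module AllTransitions where

      compᴴ : Fin M → Fin c
      compᴴ i = comp (vtx i)

      compᴴ-idx : ∀ v a → compᴴ (idx (v , a)) ≡ comp v
      compᴴ-idx v a = cong comp (vtx-idx (v , a))

      open Collapse compᴴ (λ j → idx (compRep j , zero)) (λ j → trans (compᴴ-idx (compRep j) zero) (comp∘compRep j))

      transition∈family : ∀ (v : Fin n) (t : Fin 3) → transitionVec (combine v t) ∈ family ⊤
      transition∈family v t = ∈-++⁺ˡ (∈-select⁺ transitionVec ⊤ {combine v t} ∈⊤)

      constantOnPairs : ∀ v t → ConstantOnPairs v t
      constantOnPairs v t a = trans (compᴴ-idx v a) (sym (compᴴ-idx v (mate t a)))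

      family⊆ker : ∀ {x} → x ∈ family ⊤ → collapse x ≡ 𝟘
      family⊆ker p with ∈-++⁻ (select transitionVec ⊤) p
      ... | inj₁ q with ∈-select⁻ transitionVec ⊤ q
      ... | g , _ , refl = collapse-pairVec (constantOnPairs (proj₁ (remQuot {n} 3 g)) (proj₂ (remQuot {n} 3 g)))
      family⊆ker p | inj₂ q with ∈K⁻ q
      ... | inj₁ (i , refl) = collapse-edgeVec (connected⇒comp (adjacent-σ i ◅ ε))
      ... | inj₂ (v , refl) = collapse-vertexVec (constantOnPairs v zero)

      open module Link = ContainingK (family ⊤) (∈-++⁺ʳ (select transitionVec ⊤))

      linked-connected : ∀ {u w} → Connected F u w → Linked (family ⊤) (idx (u , zero)) (idx (w , zero))
      linked-connected ε = linked-refl _ _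
      linked-connected {u} (_◅_ {j = u′} (a , b , σua≡) rest) =
        linked-trans _ (linked-vertex u (transition∈family u) zero a)
        (linked-trans _ (subst (Linked (family ⊤) (idx (u , a)) ∘ idx) σua≡ (linked-edge (u , a)))
        (linked-trans _ (linked-vertex u′ (transition∈family u′) b zero) (linked-connected rest)))

      linked-base : ∀ x → Linked (family ⊤) x (idx (vtx x , zero))
      linked-base x = subst (λ z → Linked (family ⊤) z (idx (vtx x , zero))) (idx∘unidx x)
        (linked-vertex (vtx x) (transition∈family (vtx x)) (proj₂ (unidx x)) zero)

      links : ∀ {x y} → compᴴ x ≡ compᴴ y → Linked (family ⊤) x y
      links {x} {y} eq = linked-trans _ (linked-base x)
        (linked-trans _ (linked-connected (comp⇒connected eq)) (linked-sym _ (linked-base y)))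

      rk-family : rk (family ⊤) + c ≡ M
      rk-family = rk-partition (family ⊤) family⊆ker links

    rank-⊤ : rank ⊤ ≡ n
    rank-⊤ = +-cancelʳ-≡ c _ _ (rank-formula ⊤ c AllTransitions.rk-family)

    rank-τ : ∀ (P : CircuitPartition F) S → IsTau P S → rank S + size P ≡ n + c
    rank-τ P S τP≡S = rank-formula S (size P) (CircuitClasses.rk-family P S τP≡S)


theorem1 : (n : ℕ) (F : FourRegular n) →
    Σ (Matroid (n * 3)) λ M →
      (Matroid.rank M ⊤ ≡ n) ×
      (∀ (c : ℕ) → HasComponents F c →
        ∀ (P : CircuitPartition F) (S : Subset (n * 3)) → IsTau P S →
          Matroid.rank M S + size P ≡ n + c)
theorem1 n F =
  matroid ,
  Components.rank-⊤ (proj₁ hasComponents) (proj₂ hasComponents) ,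
  λ c hc → Components.rank-τ c hc
  where open TransitionMatroid F
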